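{- Let $n,m$ be positive integers and let $A\ge 2$ be an integer. Let $\zeta_n=e^{2\pi\sqrt{ -1}/n}$ and for positive integers $s_1,\dots,s_m$ put $$\mathfrak Z_n(\zeta_n;;s_1,\dots,s_m)=\sum_{1\le i_1<\dots<i_m\le n-1}\prod_{k=1}^m\frac{1}{(1-\zeta_n^{i_k})^{s_k}}.$$ Write $\mathfrak Z_n(\zeta_n;;1^{j-1},A,1^{m-j})$ for this sum with $s_j=A$ and $s_i=1$ for $i\ne j$. Then \begin{align*} \sum_{j=1}^{m}\mathfrak Z_n(\zeta_n;;1^{j-1},A,1^{m-j}) &=\sum_{k=0}^{A-3}\sum_{j=1}^{A-k-1}\frac{(-1)^{k+1}n^j\beta_j(n^{ -1})}{(m+k+1)\,j!}\binom{n-1}{m+k}\binom{A-k-2}{j-1}\\ &\quad+(-1)^{A+1}\frac{(m+A-2)(n-2 m-2 A+1)}{2(m+A-1)(m+A)}\binom{n-1}{m+A-2}. \end{align*}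
   Context: The degenerate Bernoulli numbers $\beta_k(\lambda)$ (Carlitz) are defined by $\dfrac{t}{(1+\lambda t)^{1/\lambda}-1}=\sum_{k=0}^\infty\beta_k(\lambda)\dfrac{t^k}{k!}$. Binomial coefficients $\binom{a}{b}$ vanish for $b>a$ or $b<0$; empty sums are $0$. -}

module Defs where

open import Level using (Level; _⊔_) renaming (suc to lsuc)
open import Data.Nat as ℕ using (ℕ; zero; suc; _∸_; _≡ᵇ_; NonZero)
open import Data.Nat.Combinatorics using (_C_)
open import Data.Nat using (_!)
open import Data.Integer as ℤ using (ℤ; +_; -[1+_])
open import Data.Rational as ℚ using (ℚ; ↥_; ↧ₙ_)
open import Data.List using (List; []; _∷_; _++_; [_]; length; map; upTo; foldr; zip)
open import Data.Bool using (if_then_else_)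
open import Relation.Nullary using (¬_)
open import Algebra.Bundles using (CommutativeRing)

module RingOps {c ℓ} (R : CommutativeRing c ℓ) where
  open CommutativeRing R

  pow : Carrier → ℕ → Carrier
  pow x zero    = 1#
  pow x (suc k) = x * pow x k

  natR : ℕ → Carrier
  natR zero    = 0#
  natR (suc k) = 1# + natR k

  intR : ℤ → Carrier
  intR (+ k)      = natR k
  intR -[1+ k ]   = - natR (suc k)

  sumR : List Carrier → Carrier
  sumR = foldr _+_ 0#

-- A field of characteristic 0 (the stdlib has no Field bundle).
-- _⁻¹ is total; it is only required to be a two-sided inverse on
-- nonzero elements.

record Char0Field c ℓ : Set (lsuc (c ⊔ ℓ)) where
  field
    cring : CommutativeRing c ℓ
  open CommutativeRing cring public
  open RingOps cring public
  field
    _⁻¹        : Carrier → Carrier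
    ⁻¹-inverse : ∀ x → ¬ (x ≈ 0#) → x * (x ⁻¹) ≈ 1#
    char0      : ∀ k → ¬ (natR (suc k) ≈ 0#)

  ι : ℚ → Carrier
  ι q = intR (↥ q) * (natR (↧ₙ q)) ⁻¹

  IsPrimitiveRoot : ℕ → Carrier → Set ℓ
  IsPrimitiveRoot n ζ = (pow ζ n ≈ 1#) × (∀ k → 1 ℕ.≤ k → k ℕ.< n → ¬ (pow ζ k ≈ 1#))
    where open import Data.Product using (_×_)

  -- 𝔷_n(ζ ; s_1,…,s_m) = Σ_{lo ≤ i_1 < … < i_m ≤ n-1} Π_k (1 - ζ^{i_k})^{-s_k}
  -- (zsumFrom n ζ lo s); the paper's sum is the case lo = 1.
  zsumFrom : ℕ → Carrier → ℕ → List ℕ → Carrier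
  zsumFrom n ζ lo []      = 1#
  zsumFrom n ζ lo (s ∷ ss) =
    sumR (map (λ i → pow ((1# - pow ζ i) ⁻¹) s * zsumFrom n ζ (suc i) ss)
              (map (lo ℕ.+_) (upTo (n ∸ lo))))

  ℨ : ℕ → Carrier → List ℕ → Carrier
  ℨ n ζ s = zsumFrom n ζ 1 s

sumℚ : List ℚ → ℚ
sumℚ = foldr ℚ._+_ ℚ.0ℚ

-- division by a natural number (by 0 yields 0; never used with 0 below)
_÷ℕ_ : ℚ → ℕ → ℚ
q ÷ℕ zero  = ℚ.0ℚ
q ÷ℕ suc k = q ℚ.* (+ 1 ℚ./ suc k)

ℕtoℚ : ℕ → ℚ
ℕtoℚ k = + k ℚ./ 1

ℤtoℚ : ℤ → ℚ
ℤtoℚ z = z ℚ./ 1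

powℚ : ℚ → ℕ → ℚ
powℚ q zero    = ℚ.1ℚ
powℚ q (suc k) = q ℚ.* powℚ q k

sign : ℕ → ℚ
sign k = powℚ (ℚ.- ℚ.1ℚ) k

-- Degenerate Bernoulli numbers β_k(λ) (Carlitz).
-- (1+λt)^{1/λ} = Σ_k (1)_{k,λ} t^k/k!  with (1)_{k,λ} = Π_{i<k} (1 - iλ).
-- Comparing coefficients of t^{N+1}/(N+1)! in
--   t = (Σ_k β_k(λ) t^k/k!) · ((1+λt)^{1/λ} - 1)
-- gives  [N = 0] = Σ_{k=0}^{N} C(N+1,k) β_k(λ) (1)_{N+1-k,λ},  and (1)_{1,λ} = 1, so
--   β_N(λ) = ([N=0] - Σ_{k<N} C(N+1,k) β_k(λ) (1)_{N+1-k,λ}) / (N+1).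

degFall : ℚ → ℕ → ℚ
degFall lam zero    = ℚ.1ℚ
degFall lam (suc k) = degFall lam k ℚ.* (ℚ.1ℚ ℚ.- (ℕtoℚ k ℚ.* lam))

βstep : ℚ → List ℚ → ℚ
βstep lam bs =
  (δ ℚ.- sumℚ (map (λ kb → ℕtoℚ (suc N C proj₁ kb) ℚ.* proj₂ kb ℚ.* degFall lam (suc N ∸ proj₁ kb))
                   (zip (upTo N) bs))) ÷ℕ suc N
  where
    open import Data.Product using (proj₁; proj₂)
    N = length bs
    δ = if N ≡ᵇ 0 then ℚ.1ℚ else ℚ.0ℚ

βlist : ℚ → ℕ → List ℚ
βlist lam zero    = []
βlist lam (suc N) = βlist lam N ++ [ βstep lam (βlist lam N) ]

β : ℚ → ℕ → ℚ
β lam N = βstep lam (βlist lam N)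

-- exponent vector (1^{j-1}, A, 1^{m-j}), for j = jj + 1 with jj ∈ {0,…,m-1}
expo : ℕ → ℕ → ℕ → List ℕ
expo m A jj = map (λ i → if i ≡ᵇ jj then A else 1) (upTo m)

rhs : (n m A : ℕ) → ℚ
rhs n m A =
  sumℚ (map (λ k →
    sumℚ (map (λ j →
        (sign (suc k) ℚ.* powℚ (ℕtoℚ n) j ℚ.* β (+ 1 ℚ./ suc (n ∸ 1)) j
          ÷ℕ ((m ℕ.+ k ℕ.+ 1) ℕ.* (j !)))
        ℚ.* ℕtoℚ ((n ∸ 1) C (m ℕ.+ k))
        ℚ.* ℕtoℚ ((A ∸ k ∸ 2) C (j ∸ 1)))
      (map suc (upTo (A ∸ k ∸ 1)))))
    (upTo (A ∸ 2)))
  ℚ.+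
  ((sign (suc A) ℚ.* ℕtoℚ (m ℕ.+ A ∸ 2)
      ℚ.* ℤtoℚ (+ n ℤ.- + (2 ℕ.* m ℕ.+ 2 ℕ.* A) ℤ.+ + 1))
     ÷ℕ (2 ℕ.* (m ℕ.+ A ∸ 1) ℕ.* (m ℕ.+ A)))
  ℚ.* ℕtoℚ ((n ∸ 1) C (m ℕ.+ A ∸ 2))

{-# OPTIONS --safe #-}
module Submission where

-- With x i = 1 / (1 - ζ^i) for 1 ≤ i ≤ n - 1, the left-hand side T_A(m) is a sum of multiple
-- sums of the x i with one exponent A and m - 1 exponents 1.  Splitting off the smallest index
-- gives the Newton-type recursion T_A(m + 1) = p_A e_m - T_{A+1}(m) in the power sums p_A and the
-- elementary symmetric functions e_m of the x i, ending in T_1(M) = M e_M.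
-- Both Π_i (1 + t x i) and ((1 + t)^n - 1) / (n t) are polynomials of degree < n which agree at
-- t = 0 and at the n - 1 points ζ^i - 1, so e_k = C(n, k + 1) / n =: ê_k.  The reciprocal of
-- ê(X) = Σ_k ê_k X^k is b(X) = n X / ((1 + X)^n - 1) = Σ_j n^j β_j(1/n) X^j / j!, and
-- V(X) = b(X / (1 - X)) satisfies V(X) ê(-X) = (1 - X)^(n-1).  This is Newton's identity for the
-- sequence -V, hence p_j = -V_j = -Σ_i C(j - 1, i - 1) n^i β_i(1/n) / i! for j ≥ 1.  Unrolling
-- the recursion from T_A(m) down to T_1 and inserting these values gives the first line of the
-- formula; the last two terms, with p_1 = (n - 1) / 2, combine into the second line.

open import Defs
open import Level using (Level)
open import Algebra.Bundles using (CommutativeRing)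
import Algebra.Solver.Ring
import Algebra.Solver.Ring.AlmostCommutativeRing as ACR
open import Data.Bool using (if_then_else_)
import Data.Empty.Irrelevant as Irrelevant
open import Data.Fin using (toℕ)
open import Data.Integer as ℤ using (ℤ; +_; -[1+_]; _⊖_; ∣_∣)
import Data.Integer.Properties as ℤ
open import Data.List using (List; []; _∷_; _++_; [_]; map; upTo; applyUpTo; length; zip)
import Data.List.Properties as List
open import Data.List.Relation.Unary.All using (All; []; _∷_)
import Data.List.Relation.Unary.All.Properties as All
open import Data.List.Relation.Unary.AllPairs using (AllPairs; []; _∷_)
import Data.List.Relation.Unary.AllPairs.Properties as AllPairs
open import Data.Maybe using (Maybe; just; nothing)
open import Data.Nat as ℕ using (ℕ; zero; suc; _<_; _≤_; s≤s; z≤n; _∸_; _≡ᵇ_; _!; NonZero)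
import Data.Nat.Properties as ℕ
import Data.Nat.DivMod as ℕ
open import Data.Nat.Combinatorics
  using (_C_; nC1≡n; nCk≡nC[n∸k]; k>n⇒nCk≡0; nCk+nC[k+1]≡[n+1]C[k+1]; nCk≡n!/k![n-k]!; k![n∸k]!∣n!)
open import Data.Product using (_,_; proj₁; proj₂)
open import Data.Rational as ℚ using (ℚ; mkℚ)
import Data.Rational.Properties as ℚ
import Data.Rational.Unnormalised as ℚᵘ
open import Data.Sign as Sign using (Sign)
open import Function using (_∘_; id)
open import Relation.Binary.PropositionalEquality as ≡ using (_≡_; _≢_)
open import Relation.Nullary using (yes; no; ¬_)
import Relation.Binary.Reasoning.Setoid

-- Natural numbers

[1+k]*[1+n]C[1+k]≡[1+n]*nCk : ∀ n k → suc k ℕ.* (suc n C suc k) ≡ suc n ℕ.* (n C k)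
[1+k]*[1+n]C[1+k]≡[1+n]*nCk zero    zero    = ≡.refl
[1+k]*[1+n]C[1+k]≡[1+n]*nCk zero    (suc k) = ℕ.*-zeroʳ (suc (suc k))
[1+k]*[1+n]C[1+k]≡[1+n]*nCk (suc n) zero    =
  ≡.trans (ℕ.*-identityˡ _) (≡.trans (nC1≡n (suc (suc n))) (≡.sym (ℕ.*-identityʳ (suc (suc n)))))
[1+k]*[1+n]C[1+k]≡[1+n]*nCk (suc n) (suc k) = begin
  suc (suc k) ℕ.* (suc (suc n) C suc (suc k))                 ≡⟨ ≡.cong (suc (suc k) ℕ.*_) (nCk+nC[k+1]≡[n+1]C[k+1] (suc n) (suc k)) ⟨
  suc (suc k) ℕ.* (a ℕ.+ b)                                   ≡⟨ ℕ.*-distribˡ-+ (suc (suc k)) a b ⟩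
  suc (suc k) ℕ.* a ℕ.+ suc (suc k) ℕ.* b                     ≡⟨ ≡.cong (suc (suc k) ℕ.* a ℕ.+_) ([1+k]*[1+n]C[1+k]≡[1+n]*nCk n (suc k)) ⟩
  (a ℕ.+ suc k ℕ.* a) ℕ.+ suc n ℕ.* (n C suc k)               ≡⟨ ≡.cong (λ z → (a ℕ.+ z) ℕ.+ suc n ℕ.* (n C suc k)) ([1+k]*[1+n]C[1+k]≡[1+n]*nCk n k) ⟩
  (a ℕ.+ suc n ℕ.* (n C k)) ℕ.+ suc n ℕ.* (n C suc k)         ≡⟨ ℕ.+-assoc a _ _ ⟩
  a ℕ.+ (suc n ℕ.* (n C k) ℕ.+ suc n ℕ.* (n C suc k))         ≡⟨ ≡.cong (a ℕ.+_) (ℕ.*-distribˡ-+ (suc n) (n C k) (n C suc k)) ⟨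
  a ℕ.+ suc n ℕ.* (n C k ℕ.+ n C suc k)                       ≡⟨ ≡.cong (λ z → a ℕ.+ suc n ℕ.* z) (nCk+nC[k+1]≡[n+1]C[k+1] n k) ⟩
  a ℕ.+ suc n ℕ.* a                                           ∎
  where
  open ≡.≡-Reasoning
  a b : ℕ
  a = suc n C suc k
  b = suc n C suc (suc k)

[1+k]*nC[1+k]+k*nCk≡n*nCk : ∀ n k → suc k ℕ.* (n C suc k) ℕ.+ k ℕ.* (n C k) ≡ n ℕ.* (n C k)
[1+k]*nC[1+k]+k*nCk≡n*nCk zero    zero    = ≡.refl
[1+k]*nC[1+k]+k*nCk≡n*nCk zero    (suc k) = ≡.cong₂ ℕ._+_ (ℕ.*-zeroʳ (suc (suc k))) (ℕ.*-zeroʳ (suc k))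
[1+k]*nC[1+k]+k*nCk≡n*nCk (suc n) zero    =
  ≡.trans (ℕ.+-identityʳ _) (≡.trans (ℕ.*-identityˡ _) (≡.trans (nC1≡n (suc n)) (≡.sym (ℕ.*-identityʳ (suc n)))))
[1+k]*nC[1+k]+k*nCk≡n*nCk (suc n) (suc k) = begin
  suc (suc k) ℕ.* (suc n C suc (suc k)) ℕ.+ suc k ℕ.* (suc n C suc k)
    ≡⟨ ≡.cong₂ ℕ._+_ ([1+k]*[1+n]C[1+k]≡[1+n]*nCk n (suc k)) ([1+k]*[1+n]C[1+k]≡[1+n]*nCk n k) ⟩
  suc n ℕ.* (n C suc k) ℕ.+ suc n ℕ.* (n C k)    ≡⟨ ℕ.*-distribˡ-+ (suc n) (n C suc k) (n C k) ⟨
  suc n ℕ.* (n C suc k ℕ.+ n C k)                ≡⟨ ≡.cong (suc n ℕ.*_) (≡.trans (ℕ.+-comm (n C suc k) (n C k)) (nCk+nC[k+1]≡[n+1]C[k+1] n k)) ⟩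
  suc n ℕ.* (suc n C suc k)                      ∎
  where open ≡.≡-Reasoning

nCk*k![n∸k]!≡n! : ∀ {n k} → k ≤ n → (n C k) ℕ.* (k ! ℕ.* (n ∸ k) !) ≡ n !
nCk*k![n∸k]!≡n! {n} {k} k≤n = ≡.trans (≡.cong (ℕ._* (k ! ℕ.* (n ∸ k) !)) (nCk≡n!/k![n-k]! k≤n))
                                      (ℕ.m/n*n≡m {{ℕ._!*_!≢0 k (n ∸ k)}} (k![n∸k]!∣n! k≤n))

downward-induction : ∀ {a} (N : ℕ) (P : ℕ → Set a) →
  (∀ lo → N < lo → P lo) → (∀ lo → lo ≤ N → P (suc lo) → P lo) → ∀ lo → P lo
downward-induction N P above step lo = go (suc N) lo (ℕ.m≤m+n (suc N) lo)
  where
  go : ∀ fuel lo → suc N ≤ fuel ℕ.+ lo → P lo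
  go zero        lo N<lo = above lo N<lo
  go (suc fuel) lo N<fuel+lo with lo ℕ.≤? N
  ... | yes lo≤N = step lo lo≤N (go fuel (suc lo) (ℕ.≤-trans N<fuel+lo (ℕ.≤-reflexive (≡.sym (ℕ.+-suc fuel lo)))))
  ... | no  lo≰N = above lo (ℕ.≰⇒> lo≰N)

-- Commutative rings and fields

module RingArithmetic {c ℓ} (R : CommutativeRing c ℓ) where
  open CommutativeRing R
  open RingOps R
  open import Algebra.Properties.Ring ring using (-‿+-comm; -‿involutive; -0#≈0#; -1*x≈-x)
  open import Algebra.Properties.CommutativeSemigroup +-commutativeSemigroup using (interchange)
  open import Algebra.Properties.CommutativeSemigroup *-commutativeSemigroup using () renaming (interchange to *-interchange)
  open import Algebra.Properties.Semiring.Mult semiring using (_×_; ×-homo-+; ×1-homo-*)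
  import Algebra.Properties.Semiring.Mult.TCOptimised semiring as Fast
  open import Algebra.Properties.Semiring.Exp semiring using (_^_; ^-homo-*; ^-assocʳ; ^-congˡ)
  open import Algebra.Properties.CommutativeSemiring.Exp commutativeSemiring using (^-distrib-*)
  open import Relation.Binary.Reasoning.Setoid setoid

  natR≈×1# : ∀ k → natR k ≈ k × 1#
  natR≈×1# zero    = refl
  natR≈×1# (suc k) = +-congˡ (natR≈×1# k)

  natR-homo-+ : ∀ a b → natR (a ℕ.+ b) ≈ natR a + natR b
  natR-homo-+ a b = trans (natR≈×1# (a ℕ.+ b))
    (trans (×-homo-+ 1# a b) (sym (+-cong (natR≈×1# a) (natR≈×1# b))))

  natR-homo-* : ∀ a b → natR (a ℕ.* b) ≈ natR a * natR b
  natR-homo-* a b = trans (natR≈×1# (a ℕ.* b))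
    (trans (×1-homo-* a b) (sym (*-cong (natR≈×1# a) (natR≈×1# b))))

  signR : Sign → Carrier
  signR Sign.+ = 1#
  signR Sign.- = - 1#

  signR-homo-* : ∀ s t → signR (s Sign.* t) ≈ signR s * signR t
  signR-homo-* Sign.+ t      = sym (*-identityˡ _)
  signR-homo-* Sign.- Sign.+ = sym (*-identityʳ _)
  signR-homo-* Sign.- Sign.- = sym (trans (-1*x≈-x (- 1#)) (-‿involutive 1#))

  intR-◃ : ∀ s k → intR (s ℤ.◃ k) ≈ signR s * natR k
  intR-◃ s      zero    = sym (zeroʳ _)
  intR-◃ Sign.+ (suc k) = sym (*-identityˡ _)
  intR-◃ Sign.- (suc k) = sym (-1*x≈-x _)

  intR-homo-* : ∀ i j → intR (i ℤ.* j) ≈ intR i * intR j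
  intR-homo-* i j = begin
    intR (i ℤ.* j)
      ≈⟨ intR-◃ (ℤ.sign i Sign.* ℤ.sign j) (∣ i ∣ ℕ.* ∣ j ∣) ⟩
    signR (ℤ.sign i Sign.* ℤ.sign j) * natR (∣ i ∣ ℕ.* ∣ j ∣)
      ≈⟨ *-cong (signR-homo-* (ℤ.sign i) (ℤ.sign j)) (natR-homo-* ∣ i ∣ ∣ j ∣) ⟩
    (signR (ℤ.sign i) * signR (ℤ.sign j)) * (natR ∣ i ∣ * natR ∣ j ∣)
      ≈⟨ *-interchange _ _ _ _ ⟩
    (signR (ℤ.sign i) * natR ∣ i ∣) * (signR (ℤ.sign j) * natR ∣ j ∣)
      ≈⟨ *-cong (signed i) (signed j) ⟩
    intR i * intR j ∎
    where
    signed : ∀ k → signR (ℤ.sign k) * natR ∣ k ∣ ≈ intR k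
    signed k = trans (sym (intR-◃ (ℤ.sign k) ∣ k ∣)) (reflexive (≡.cong intR (ℤ.◃-inverse k)))

  intR-homo-neg : ∀ i → intR (ℤ.- i) ≈ - intR i
  intR-homo-neg -[1+ k ]    = sym (-‿involutive _)
  intR-homo-neg (+ zero)    = sym -0#≈0#
  intR-homo-neg (+ (suc k)) = refl

  intR-⊖ : ∀ m n → intR (m ⊖ n) ≈ natR m - natR n
  intR-⊖ m       zero    = sym (trans (+-congˡ -0#≈0#) (+-identityʳ _))
  intR-⊖ zero    (suc n) = sym (+-identityˡ _)
  intR-⊖ (suc m) (suc n) = begin
    intR (suc m ⊖ suc n)            ≡⟨ ≡.cong intR (ℤ.[1+m]⊖[1+n]≡m⊖n m n) ⟩
    intR (m ⊖ n)                    ≈⟨ intR-⊖ m n ⟩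
    natR m - natR n                 ≈⟨ +-identityˡ _ ⟨
    0# + (natR m - natR n)          ≈⟨ +-congʳ (-‿inverseʳ 1#) ⟨
    (1# - 1#) + (natR m - natR n)   ≈⟨ interchange 1# (- 1#) (natR m) (- natR n) ⟩
    natR (suc m) + (- 1# - natR n)  ≈⟨ +-congˡ (-‿+-comm 1# (natR n)) ⟩
    natR (suc m) - natR (suc n)     ∎

  intR-homo-+ : ∀ i j → intR (i ℤ.+ j) ≈ intR i + intR j
  intR-homo-+ -[1+ m ] -[1+ n ] = begin
    - natR (suc (suc (m ℕ.+ n)))     ≡⟨ ≡.cong (λ k → - natR (suc k)) (ℕ.+-suc m n) ⟨
    - natR (suc m ℕ.+ suc n)         ≈⟨ -‿cong (natR-homo-+ (suc m) (suc n)) ⟩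
    - (natR (suc m) + natR (suc n))  ≈⟨ -‿+-comm _ _ ⟨
    - natR (suc m) - natR (suc n)    ∎
  intR-homo-+ -[1+ m ] (+ n)    = trans (intR-⊖ n (suc m)) (+-comm _ _)
  intR-homo-+ (+ m)    -[1+ n ] = intR-⊖ m (suc n)
  intR-homo-+ (+ m)    (+ n)    = natR-homo-+ m n

  -- The solver's ℤ coefficients must denote 1 by 1# itself rather than by 1# + 0#,
  -- hence the type-checking optimised multiplication.
  coeff : ℤ → Carrier
  coeff (+ k)     = k Fast.× 1#
  coeff -[1+ k ] = - (suc k Fast.× 1#)

  coeff≈intR : ∀ i → coeff i ≈ intR i
  coeff≈intR (+ k)     = sym (trans (natR≈×1# k) (Fast.×ᵤ≈× k 1#))
  coeff≈intR -[1+ k ] = -‿cong (sym (trans (natR≈×1# (suc k)) (Fast.×ᵤ≈× (suc k) 1#)))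

  coeff-morphism : ACR._-Raw-AlmostCommutative⟶_ ℤ.+-*-rawRing (ACR.fromCommutativeRing R)
  coeff-morphism = record
    { ⟦_⟧    = coeff
    ; +-homo = λ i j → transported {i ℤ.+ j} (intR-homo-+ i j) (+-cong (coeff≈intR i) (coeff≈intR j))
    ; *-homo = λ i j → transported {i ℤ.* j} (intR-homo-* i j) (*-cong (coeff≈intR i) (coeff≈intR j))
    ; -‿homo = λ i → transported {ℤ.- i} (intR-homo-neg i) (-‿cong (coeff≈intR i))
    ; 0-homo = refl
    ; 1-homo = refl
    }
    where
    transported : ∀ {i x y} → intR i ≈ x → y ≈ x → coeff i ≈ y
    transported {i} e e′ = trans (coeff≈intR i) (trans e (sym e′))

  coeff-equal? : ∀ i j → Maybe (coeff i ≈ coeff j)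
  coeff-equal? i j with i ℤ.≟ j
  ... | yes i≡j = just (reflexive (≡.cong coeff i≡j))
  ... | no  _   = nothing

  module RingSolver = Algebra.Solver.Ring ℤ.+-*-rawRing (ACR.fromCommutativeRing R) coeff-morphism coeff-equal?

  pow≈^ : ∀ x k → pow x k ≈ x ^ k
  pow≈^ x zero    = refl
  pow≈^ x (suc k) = *-congˡ (pow≈^ x k)

  pow-cong : ∀ k {x y} → x ≈ y → pow x k ≈ pow y k
  pow-cong k {x} {y} x≈y = trans (pow≈^ x k) (trans (^-congˡ k x≈y) (sym (pow≈^ y k)))

  pow-homo-+ : ∀ x a b → pow x (a ℕ.+ b) ≈ pow x a * pow x b
  pow-homo-+ x a b = trans (pow≈^ x (a ℕ.+ b))
    (trans (^-homo-* x a b) (sym (*-cong (pow≈^ x a) (pow≈^ x b))))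

  pow-distrib-* : ∀ x y k → pow (x * y) k ≈ pow x k * pow y k
  pow-distrib-* x y k = trans (pow≈^ (x * y) k)
    (trans (^-distrib-* x y k) (sym (*-cong (pow≈^ x k) (pow≈^ y k))))

  pow-pow : ∀ x a b → pow (pow x a) b ≈ pow x (a ℕ.* b)
  pow-pow x a b = trans (pow-cong b (pow≈^ x a))
    (trans (pow≈^ (x ^ a) b) (trans (^-assocʳ x a b) (sym (pow≈^ x (a ℕ.* b)))))

  pow-1# : ∀ k → pow 1# k ≈ 1#
  pow-1# zero    = refl
  pow-1# (suc k) = trans (*-identityˡ _) (pow-1# k)

  sgn : ℕ → Carrier
  sgn k = pow (- 1#) k

  sgn-suc : ∀ k → sgn (suc k) ≈ - sgn k
  sgn-suc k = -1*x≈-x (sgn k)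

  sgn*sgn : ∀ k → sgn k * sgn k ≈ 1#
  sgn*sgn zero    = *-identityʳ 1#
  sgn*sgn (suc k) = begin
    sgn (suc k) * sgn (suc k)   ≈⟨ *-cong (sgn-suc k) (sgn-suc k) ⟩
    - sgn k * - sgn k           ≈⟨ solve 1 (λ s → (:- s) :* (:- s) := s :* s) refl (sgn k) ⟩
    sgn k * sgn k               ≈⟨ sgn*sgn k ⟩
    1#                          ∎
    where open RingSolver using (solve; _:*_; :-_; _:=_)

module FiniteSums {c ℓ} (R : CommutativeRing c ℓ) where
  open CommutativeRing R
  open RingOps R
  open RingArithmetic R
  open import Algebra.Properties.Ring ring using (-‿+-comm; -0#≈0#)
  open import Algebra.Properties.Semiring.Sum semiring using (sum)
  open import Algebra.Properties.CommutativeSemigroup +-commutativeSemigroup using (interchange)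
  open import Algebra.Properties.Semiring.Exp semiring using (_^_)
  open import Algebra.Properties.Semiring.Mult semiring using (_×_; ×-congʳ; ×-assoc-*)
  import Algebra.Properties.CommutativeSemiring.Binomial commutativeSemiring as Binomial
  open import Relation.Binary.Reasoning.Setoid setoid

  Σ : ℕ → (ℕ → Carrier) → Carrier
  Σ zero    f = 0#
  Σ (suc k) f = f 0 + Σ k (f ∘ suc)

  Σ≡sum : ∀ k f → Σ k f ≡ sum {k} (λ i → f (toℕ i))
  Σ≡sum zero    f = ≡.refl
  Σ≡sum (suc k) f = ≡.cong (λ s → f 0 + s) (Σ≡sum k (f ∘ suc))

  Σ-cong< : ∀ k {f g} → (∀ i → i < k → f i ≈ g i) → Σ k f ≈ Σ k g
  Σ-cong< zero    f≈g = refl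
  Σ-cong< (suc k) f≈g = +-cong (f≈g 0 (s≤s z≤n)) (Σ-cong< k (λ i i<k → f≈g (suc i) (s≤s i<k)))

  Σ-cong : ∀ k {f g} → (∀ i → f i ≈ g i) → Σ k f ≈ Σ k g
  Σ-cong k f≈g = Σ-cong< k (λ i _ → f≈g i)

  Σ-distrib-+ : ∀ k f g → Σ k (λ i → f i + g i) ≈ Σ k f + Σ k g
  Σ-distrib-+ zero    f g = sym (+-identityˡ 0#)
  Σ-distrib-+ (suc k) f g = trans (+-congˡ (Σ-distrib-+ k (f ∘ suc) (g ∘ suc))) (interchange _ _ _ _)

  *-distribˡ-Σ : ∀ k x f → x * Σ k f ≈ Σ k (λ i → x * f i)
  *-distribˡ-Σ zero    x f = zeroʳ x
  *-distribˡ-Σ (suc k) x f = trans (distribˡ x _ _) (+-congˡ (*-distribˡ-Σ k x (f ∘ suc)))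

  *-distribʳ-Σ : ∀ k x f → Σ k f * x ≈ Σ k (λ i → f i * x)
  *-distribʳ-Σ k x f = trans (*-comm _ x) (trans (*-distribˡ-Σ k x f) (Σ-cong k (λ i → *-comm x (f i))))

  Σ-zero : ∀ k f → (∀ i → i < k → f i ≈ 0#) → Σ k f ≈ 0#
  Σ-zero zero    f f≈0 = refl
  Σ-zero (suc k) f f≈0 =
    trans (+-cong (f≈0 0 (s≤s z≤n)) (Σ-zero k (f ∘ suc) (λ i i<k → f≈0 (suc i) (s≤s i<k))))
          (+-identityˡ 0#)

  Σ-swap : ∀ a b (f : ℕ → ℕ → Carrier) → Σ a (λ i → Σ b (f i)) ≈ Σ b (λ j → Σ a (λ i → f i j))
  Σ-swap zero    b f = sym (Σ-zero b (λ _ → 0#) (λ _ _ → refl))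
  Σ-swap (suc a) b f = trans (+-congˡ (Σ-swap a b (f ∘ suc))) (sym (Σ-distrib-+ b (f 0) _))

  -‿distrib-Σ : ∀ k f → - Σ k f ≈ Σ k (λ i → - f i)
  -‿distrib-Σ zero    f = -0#≈0#
  -‿distrib-Σ (suc k) f = trans (sym (-‿+-comm _ _)) (+-congˡ (-‿distrib-Σ k (f ∘ suc)))

  Σ-distrib-− : ∀ k f g → Σ k (λ i → f i - g i) ≈ Σ k f - Σ k g
  Σ-distrib-− k f g = trans (Σ-distrib-+ k f (λ i → - g i)) (+-congˡ (sym (-‿distrib-Σ k g)))

  Σ-const : ∀ k x → Σ k (λ _ → x) ≈ natR k * x
  Σ-const zero    x = sym (zeroˡ x)
  Σ-const (suc k) x = trans (+-congˡ (Σ-const k x)) (sym (trans (distribʳ x 1# (natR k)) (+-congʳ (*-identityˡ x))))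

  Σ-snoc : ∀ k f → Σ (suc k) f ≈ Σ k f + f k
  Σ-snoc zero    f = trans (+-identityʳ _) (sym (+-identityˡ _))
  Σ-snoc (suc k) f = trans (+-congˡ (Σ-snoc k (f ∘ suc))) (sym (+-assoc _ _ _))

  Σ-split : ∀ a b f → Σ (a ℕ.+ b) f ≈ Σ a f + Σ b (λ i → f (a ℕ.+ i))
  Σ-split zero    b f = sym (+-identityˡ _)
  Σ-split (suc a) b f = trans (+-congˡ (Σ-split a b (f ∘ suc))) (sym (+-assoc _ _ _))

  Σ-vanishing-tail : ∀ k d f → (∀ i → k ≤ i → f i ≈ 0#) → Σ (k ℕ.+ d) f ≈ Σ k f
  Σ-vanishing-tail k d f tail≈0 = begin
    Σ (k ℕ.+ d) f                           ≈⟨ Σ-split k d f ⟩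
    Σ k f + Σ d (λ i → f (k ℕ.+ i))          ≈⟨ +-congˡ (Σ-zero d _ (λ i _ → tail≈0 (k ℕ.+ i) (ℕ.m≤m+n k i))) ⟩
    Σ k f + 0#                               ≈⟨ +-identityʳ _ ⟩
    Σ k f                                    ∎

  sumR-map-upTo : ∀ k f → sumR (map f (upTo k)) ≈ Σ k f
  sumR-map-upTo k f = trans (reflexive (≡.cong sumR (List.map-upTo f k))) (sumR-applyUpTo k f)
    where
    sumR-applyUpTo : ∀ k f → sumR (applyUpTo f k) ≈ Σ k f
    sumR-applyUpTo zero    f = refl
    sumR-applyUpTo (suc k) f = +-congˡ (sumR-applyUpTo k (f ∘ suc))

  binomial-theorem : ∀ t n → pow (1# + t) n ≈ Σ (suc n) (λ k → natR (n C k) * pow t k)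
  binomial-theorem t n = begin
    pow (1# + t) n                       ≈⟨ pow-cong n (+-comm 1# t) ⟩
    pow (t + 1#) n                       ≈⟨ pow≈^ (t + 1#) n ⟩
    (t + 1#) ^ n                         ≈⟨ Binomial.theorem n t 1# ⟩
    Binomial.binomialExpansion t 1# n    ≡⟨ Σ≡sum (suc n) (λ k → (n C k) × (t ^ k * 1# ^ (n ∸ k))) ⟨
    Σ (suc n) (λ k → (n C k) × (t ^ k * 1# ^ (n ∸ k)))
                                         ≈⟨ Σ-cong (suc n) term ⟩
    Σ (suc n) (λ k → natR (n C k) * pow t k) ∎
    where
    term : ∀ k → (n C k) × (t ^ k * 1# ^ (n ∸ k)) ≈ natR (n C k) * pow t k
    term k = begin
      (n C k) × (t ^ k * 1# ^ (n ∸ k))   ≈⟨ ×-congʳ (n C k) (*-identityˡ _) ⟨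
      (n C k) × (1# * (t ^ k * 1# ^ (n ∸ k)))
                                         ≈⟨ ×-assoc-* (n C k) 1# _ ⟨
      (n C k) × 1# * (t ^ k * 1# ^ (n ∸ k))
        ≈⟨ *-cong (sym (natR≈×1# (n C k))) (*-cong (sym (pow≈^ t k)) (trans (sym (pow≈^ 1# (n ∸ k))) (pow-1# (n ∸ k)))) ⟩
      natR (n C k) * (pow t k * 1#)      ≈⟨ *-congˡ (*-identityʳ _) ⟩
      natR (n C k) * pow t k             ∎

  Π : ℕ → (ℕ → Carrier) → Carrier
  Π zero    f = 1#
  Π (suc k) f = f 0 * Π k (f ∘ suc)

  Π-zero : ∀ k f j → j < k → f j ≈ 0# → Π k f ≈ 0#
  Π-zero (suc k) f zero    _         fj≈0 = trans (*-congʳ fj≈0) (zeroˡ _)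
  Π-zero (suc k) f (suc j) (s≤s j<k) fj≈0 = trans (*-congˡ (Π-zero k (f ∘ suc) j j<k fj≈0)) (zeroʳ _)

  Π-cong : ∀ k {f g} → (∀ i → f i ≈ g i) → Π k f ≈ Π k g
  Π-cong zero    f≈g = refl
  Π-cong (suc k) f≈g = *-cong (f≈g 0) (Π-cong k (f≈g ∘ suc))

module FieldArithmetic {c ℓ} (K : Char0Field c ℓ) where
  open Char0Field K
  open RingArithmetic cring
  open RingSolver using (solve; _:*_; _:=_)
  open import Relation.Binary.Reasoning.Setoid setoid

  1#≉0# : ¬ (1# ≈ 0#)
  1#≉0# 1≈0 = char0 0 (trans (+-identityʳ 1#) 1≈0)

  natR≉0# : ∀ {k} → k ≢ 0 → ¬ (natR k ≈ 0#)
  natR≉0# {zero}  k≢0 = λ _ → k≢0 ≡.refl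
  natR≉0# {suc k} _   = char0 k

  ⁻¹-inverseˡ : ∀ x → ¬ (x ≈ 0#) → x ⁻¹ * x ≈ 1#
  ⁻¹-inverseˡ x x≉0 = trans (*-comm _ _) (⁻¹-inverse x x≉0)

  *-cancelˡ : ∀ {x y z} → ¬ (x ≈ 0#) → x * y ≈ x * z → y ≈ z
  *-cancelˡ {x} {y} {z} x≉0 xy≈xz = begin
    y                 ≈⟨ *-identityˡ y ⟨
    1# * y            ≈⟨ *-congʳ (⁻¹-inverseˡ x x≉0) ⟨
    (x ⁻¹ * x) * y    ≈⟨ *-assoc _ _ _ ⟩
    x ⁻¹ * (x * y)    ≈⟨ *-congˡ xy≈xz ⟩
    x ⁻¹ * (x * z)    ≈⟨ *-assoc _ _ _ ⟨
    (x ⁻¹ * x) * z    ≈⟨ *-congʳ (⁻¹-inverseˡ x x≉0) ⟩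
    1# * z            ≈⟨ *-identityˡ z ⟩
    z                 ∎

  x*y≈0⇒y≈0 : ∀ {x y} → ¬ (x ≈ 0#) → x * y ≈ 0# → y ≈ 0#
  x*y≈0⇒y≈0 x≉0 xy≈0 = *-cancelˡ x≉0 (trans xy≈0 (sym (zeroʳ _)))

  *-≉0 : ∀ {x y} → ¬ (x ≈ 0#) → ¬ (y ≈ 0#) → ¬ (x * y ≈ 0#)
  *-≉0 x≉0 y≉0 xy≈0 = y≉0 (x*y≈0⇒y≈0 x≉0 xy≈0)

  ⁻¹-unique : ∀ {x y} → ¬ (x ≈ 0#) → x * y ≈ 1# → y ≈ x ⁻¹
  ⁻¹-unique x≉0 xy≈1 = *-cancelˡ x≉0 (trans xy≈1 (sym (⁻¹-inverse _ x≉0)))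

  ⁻¹-cong : ∀ {x y} → ¬ (x ≈ 0#) → x ≈ y → x ⁻¹ ≈ y ⁻¹
  ⁻¹-cong {x} {y} x≉0 x≈y =
    ⁻¹-unique (λ y≈0 → x≉0 (trans x≈y y≈0)) (trans (*-congʳ (sym x≈y)) (⁻¹-inverse x x≉0))

  ⁻¹-distrib-* : ∀ {x y} → ¬ (x ≈ 0#) → ¬ (y ≈ 0#) → (x * y) ⁻¹ ≈ x ⁻¹ * y ⁻¹
  ⁻¹-distrib-* {x} {y} x≉0 y≉0 = sym (⁻¹-unique (*-≉0 x≉0 y≉0) (begin
    (x * y) * (x ⁻¹ * y ⁻¹)   ≈⟨ solve 4 (λ a b c d → (a :* b) :* (c :* d) := (a :* c) :* (b :* d)) refl x y (x ⁻¹) (y ⁻¹) ⟩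
    (x * x ⁻¹) * (y * y ⁻¹)   ≈⟨ *-cong (⁻¹-inverse x x≉0) (⁻¹-inverse y y≉0) ⟩
    1# * 1#                   ≈⟨ *-identityʳ 1# ⟩
    1#                        ∎))

  x*y≈z⇒x≈z*y⁻¹ : ∀ {x y z} → ¬ (y ≈ 0#) → x * y ≈ z → x ≈ z * y ⁻¹
  x*y≈z⇒x≈z*y⁻¹ {x} {y} {z} y≉0 xy≈z = begin
    x                  ≈⟨ *-identityʳ x ⟨
    x * 1#             ≈⟨ *-congˡ (⁻¹-inverse y y≉0) ⟨
    x * (y * y ⁻¹)     ≈⟨ *-assoc x y (y ⁻¹) ⟨
    (x * y) * y ⁻¹     ≈⟨ *-congʳ xy≈z ⟩
    z * y ⁻¹           ∎

  1#⁻¹≈1# : 1# ⁻¹ ≈ 1#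
  1#⁻¹≈1# = sym (⁻¹-unique 1#≉0# (*-identityʳ 1#))

  cross-multiply : ∀ {x y u v} → ¬ (u ≈ 0#) → ¬ (v ≈ 0#) → x * v ≈ y * u → x * u ⁻¹ ≈ y * v ⁻¹
  cross-multiply {x} {y} {u} {v} u≉0 v≉0 xv≈yu = begin
    x * u ⁻¹                      ≈⟨ *-identityʳ _ ⟨
    x * u ⁻¹ * 1#                 ≈⟨ *-congˡ (⁻¹-inverse v v≉0) ⟨
    x * u ⁻¹ * (v * v ⁻¹)         ≈⟨ solve 5 (λ x ui v vi y → x :* ui :* (v :* vi) := (x :* v) :* ui :* vi) refl x (u ⁻¹) v (v ⁻¹) y ⟩
    (x * v) * u ⁻¹ * v ⁻¹         ≈⟨ *-congʳ (*-congʳ xv≈yu) ⟩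
    (y * u) * u ⁻¹ * v ⁻¹         ≈⟨ solve 4 (λ y u ui vi → (y :* u) :* ui :* vi := y :* vi :* (u :* ui)) refl y u (u ⁻¹) (v ⁻¹) ⟩
    y * v ⁻¹ * (u * u ⁻¹)         ≈⟨ *-congˡ (⁻¹-inverse u u≉0) ⟩
    y * v ⁻¹ * 1#                 ≈⟨ *-identityʳ _ ⟩
    y * v ⁻¹                      ∎

module RationalEmbedding {c ℓ} (K : Char0Field c ℓ) where
  open Char0Field K
  open RingArithmetic cring
  open FiniteSums cring using (Σ)
  open FieldArithmetic K
  open RingSolver using (solve; _:+_; _:*_; _:=_)
  open import Algebra.Properties.Ring ring using (-‿distribˡ-*; -‿involutive; -0#≈0#)
  open import Relation.Binary.Reasoning.Setoid setoid

  ι-/ : ∀ z d → ι (z ℚ./ suc d) ≈ intR z * natR (suc d) ⁻¹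
  ι-/ z d = fraction-cong (z ℚ./ suc d) (ℚ.toℚᵘ-fromℚᵘ (ℚᵘ.mkℚᵘ z d))
    where
    fraction-cong : ∀ q → ℚ.toℚᵘ q ℚᵘ.≃ ℚᵘ.mkℚᵘ z d → ι q ≈ intR z * natR (suc d) ⁻¹
    fraction-cong (mkℚ a e _) (ℚᵘ.*≡* a[1+d]≡z[1+e]) = cross-multiply (char0 e) (char0 d) (begin
      intR a * natR (suc d)          ≈⟨ intR-homo-* a (+ suc d) ⟨
      intR (a ℤ.* + suc d)           ≡⟨ ≡.cong intR a[1+d]≡z[1+e] ⟩
      intR (z ℤ.* + suc e)           ≈⟨ intR-homo-* z (+ suc e) ⟩
      intR z * natR (suc e)          ∎)

  private
    natR[1+e]*[1+f]⁻¹ : ∀ e f → natR (suc e ℕ.* suc f) ⁻¹ ≈ natR (suc e) ⁻¹ * natR (suc f) ⁻¹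
    natR[1+e]*[1+f]⁻¹ e f =
      trans (⁻¹-cong (char0 (f ℕ.+ e ℕ.* suc f)) (natR-homo-* (suc e) (suc f))) (⁻¹-distrib-* (char0 e) (char0 f))

  ι-homo-+ : ∀ p q → ι (p ℚ.+ q) ≈ ι p + ι q
  ι-homo-+ (mkℚ a e _) (mkℚ b f _) = begin
    ι ((a ℤ.* + suc f ℤ.+ b ℤ.* + suc e) ℚ./ (suc e ℕ.* suc f))
      ≈⟨ ι-/ (a ℤ.* + suc f ℤ.+ b ℤ.* + suc e) (f ℕ.+ e ℕ.* suc f) ⟩
    intR (a ℤ.* + suc f ℤ.+ b ℤ.* + suc e) * natR (suc e ℕ.* suc f) ⁻¹
      ≈⟨ *-cong (trans (intR-homo-+ (a ℤ.* + suc f) (b ℤ.* + suc e))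
                       (+-cong (intR-homo-* a (+ suc f)) (intR-homo-* b (+ suc e))))
                (natR[1+e]*[1+f]⁻¹ e f) ⟩
    (intR a * V + intR b * U) * (U ⁻¹ * V ⁻¹)
      ≈⟨ solve 6 (λ x y u v ui vi → (x :* v :+ y :* u) :* (ui :* vi) := x :* ui :* (v :* vi) :+ y :* vi :* (u :* ui)) refl (intR a) (intR b) U V (U ⁻¹) (V ⁻¹) ⟩
    intR a * U ⁻¹ * (V * V ⁻¹) + intR b * V ⁻¹ * (U * U ⁻¹)
      ≈⟨ +-cong (*-congˡ (⁻¹-inverse V (char0 f))) (*-congˡ (⁻¹-inverse U (char0 e))) ⟩
    intR a * U ⁻¹ * 1# + intR b * V ⁻¹ * 1#
      ≈⟨ +-cong (*-identityʳ _) (*-identityʳ _) ⟩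
    intR a * U ⁻¹ + intR b * V ⁻¹ ∎
    where
    U V : Carrier
    U = natR (suc e)
    V = natR (suc f)

  ι-homo-* : ∀ p q → ι (p ℚ.* q) ≈ ι p * ι q
  ι-homo-* (mkℚ a e _) (mkℚ b f _) = begin
    ι ((a ℤ.* b) ℚ./ (suc e ℕ.* suc f))                ≈⟨ ι-/ (a ℤ.* b) (f ℕ.+ e ℕ.* suc f) ⟩
    intR (a ℤ.* b) * natR (suc e ℕ.* suc f) ⁻¹         ≈⟨ *-cong (intR-homo-* a b) (natR[1+e]*[1+f]⁻¹ e f) ⟩
    (intR a * intR b) * (U ⁻¹ * V ⁻¹)
      ≈⟨ solve 4 (λ x y ui vi → (x :* y) :* (ui :* vi) := (x :* ui) :* (y :* vi)) refl (intR a) (intR b) (U ⁻¹) (V ⁻¹) ⟩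
    intR a * U ⁻¹ * (intR b * V ⁻¹)                    ∎
    where
    U V : Carrier
    U = natR (suc e)
    V = natR (suc f)

  ι-homo-neg : ∀ p → ι (ℚ.- p) ≈ - ι p
  ι-homo-neg (mkℚ -[1+ k ]    d _) = trans (*-congʳ (sym (-‿involutive _))) (sym (-‿distribˡ-* _ _))
  ι-homo-neg (mkℚ (+ zero)    d _) = trans (zeroˡ _) (trans (sym -0#≈0#) (-‿cong (sym (zeroˡ _))))
  ι-homo-neg (mkℚ (+ (suc k)) d _) = sym (-‿distribˡ-* _ _)

  ι-homo-− : ∀ p q → ι (p ℚ.- q) ≈ ι p - ι q
  ι-homo-− p q = trans (ι-homo-+ p (ℚ.- q)) (+-congˡ (ι-homo-neg q))

  ι-0 : ι ℚ.0ℚ ≈ 0#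
  ι-0 = zeroˡ _

  ι-1 : ι ℚ.1ℚ ≈ 1#
  ι-1 = ⁻¹-inverse (natR 1) (char0 0)

  ι-ℤtoℚ : ∀ z → ι (ℤtoℚ z) ≈ intR z
  ι-ℤtoℚ z = trans (ι-/ z 0) (trans (*-congˡ (trans (⁻¹-cong (char0 0) (+-identityʳ 1#)) 1#⁻¹≈1#)) (*-identityʳ _))

  ι-ℕtoℚ : ∀ k → ι (ℕtoℚ k) ≈ natR k
  ι-ℕtoℚ k = ι-ℤtoℚ (+ k)

  ι-÷ℕ : ∀ q {d} → d ≢ 0 → ι (q ÷ℕ d) ≈ ι q * natR d ⁻¹
  ι-÷ℕ q {zero}  d≢0 = ⊥-elim (d≢0 ≡.refl)
    where open import Data.Empty using (⊥-elim)
  ι-÷ℕ q {suc d} _   = trans (ι-homo-* q _) (*-congˡ (trans (ι-/ (+ 1) d) (*-identityˡ′ _)))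
    where
    *-identityˡ′ : ∀ x → natR 1 * x ≈ x
    *-identityˡ′ x = trans (*-congʳ (+-identityʳ 1#)) (*-identityˡ x)

  ι-powℚ : ∀ q k → ι (powℚ q k) ≈ pow (ι q) k
  ι-powℚ q zero    = ι-1
  ι-powℚ q (suc k) = trans (ι-homo-* q _) (*-congˡ (ι-powℚ q k))

  ι-sign : ∀ k → ι (sign k) ≈ pow (- 1#) k
  ι-sign k = trans (ι-powℚ _ k) (pow-cong k (trans (ι-homo-neg ℚ.1ℚ) (-‿cong ι-1)))

  ι-sumℚ-applyUpTo : ∀ k (g : ℕ → ℚ) → ι (sumℚ (applyUpTo g k)) ≈ Σ k (λ i → ι (g i))
  ι-sumℚ-applyUpTo zero    g = ι-0
  ι-sumℚ-applyUpTo (suc k) g = trans (ι-homo-+ (g 0) _) (+-congˡ (ι-sumℚ-applyUpTo k (g ∘ suc)))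

  ι-sumℚ-map-upTo : ∀ k (g : ℕ → ℚ) → ι (sumℚ (map g (upTo k))) ≈ Σ k (λ i → ι (g i))
  ι-sumℚ-map-upTo k g = trans (reflexive (≡.cong (ι ∘ sumℚ) (List.map-upTo g k))) (ι-sumℚ-applyUpTo k g)

  ι-sumℚ-map-suc-upTo : ∀ k (g : ℕ → ℚ) → ι (sumℚ (map g (map suc (upTo k)))) ≈ Σ k (λ i → ι (g (suc i)))
  ι-sumℚ-map-suc-upTo k g = trans (reflexive (≡.cong (ι ∘ sumℚ) (≡.sym (List.map-∘ (upTo k))))) (ι-sumℚ-map-upTo k (g ∘ suc))

module PolynomialRoots {c ℓ} (K : Char0Field c ℓ) where
  open Char0Field K
  open RingArithmetic cring
  open FiniteSums cring
  open FieldArithmetic K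
  open RingSolver using (solve; _:+_; _:*_; _:-_; _:=_; con)
  open import Relation.Binary.Reasoning.Setoid setoid

  evalP : List Carrier → Carrier → Carrier
  evalP []       t = 0#
  evalP (a ∷ as) t = a + t * evalP as t

  evalP-applyUpTo : ∀ k f t → evalP (applyUpTo f k) t ≈ Σ k (λ i → f i * pow t i)
  evalP-applyUpTo zero    f t = refl
  evalP-applyUpTo (suc k) f t = begin
    f 0 + t * evalP (applyUpTo (f ∘ suc) k) t            ≈⟨ +-cong (sym (*-identityʳ _)) (*-congˡ (evalP-applyUpTo k (f ∘ suc) t)) ⟩
    f 0 * 1# + t * Σ k (λ i → f (suc i) * pow t i)       ≈⟨ +-congˡ (*-distribˡ-Σ k t _) ⟩
    f 0 * 1# + Σ k (λ i → t * (f (suc i) * pow t i))     ≈⟨ +-congˡ (Σ-cong k (λ i → solve 3 (λ t a b → t :* (a :* b) := a :* (t :* b)) refl t _ _)) ⟩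
    f 0 * 1# + Σ k (λ i → f (suc i) * (t * pow t i))     ∎

  -- Synthetic division by t - a: the coefficients of the quotient are the
  -- Horner values of the tails.
  quotient : Carrier → List Carrier → List Carrier
  quotient a []           = []
  quotient a (b ∷ [])     = []
  quotient a (b ∷ b′ ∷ bs) = evalP (b′ ∷ bs) a ∷ quotient a (b′ ∷ bs)

  length-quotient : ∀ a b bs → length (quotient a (b ∷ bs)) ≡ length bs
  length-quotient a b []        = ≡.refl
  length-quotient a b (b′ ∷ bs) = ≡.cong suc (length-quotient a b′ bs)

  division-identity : ∀ a t P → evalP P t ≈ evalP P a + (t - a) * evalP (quotient a P) t
  division-identity a t []           = solve 2 (λ a t → con (+ 0) := con (+ 0) :+ (t :- a) :* con (+ 0)) refl a t
    where open import Data.Integer using (+_)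
  division-identity a t (b ∷ [])     = solve 3 (λ a t b → b :+ t :* con (+ 0) := (b :+ a :* con (+ 0)) :+ (t :- a) :* con (+ 0)) refl a t b
    where open import Data.Integer using (+_)
  division-identity a t (b ∷ b′ ∷ bs) = begin
    b + t * E t                      ≈⟨ +-congˡ (*-congˡ (division-identity a t (b′ ∷ bs))) ⟩
    b + t * (E a + (t - a) * Q)      ≈⟨ solve 5 (λ b t a ea q → b :+ t :* (ea :+ (t :- a) :* q) := (b :+ a :* ea) :+ (t :- a) :* (ea :+ t :* q)) refl b t a (E a) Q ⟩
    (b + a * E a) + (t - a) * (E a + t * Q) ∎
    where
    E : Carrier → Carrier
    E = evalP (b′ ∷ bs)
    Q : Carrier
    Q = evalP (quotient a (b′ ∷ bs)) t

  zero-quotient-at-root : ∀ a P → All (_≈ 0#) (quotient a P) → evalP P a ≈ 0# → All (_≈ 0#) P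
  zero-quotient-at-root a []            _       _     = []
  zero-quotient-at-root a (b ∷ [])      _       Pa≈0 = trans (sym (trans (+-congˡ (zeroʳ a)) (+-identityʳ b))) Pa≈0 ∷ []
  zero-quotient-at-root a (b ∷ b′ ∷ bs) (q≈0 ∷ qs≈0) Pa≈0 = b≈0 ∷ zero-quotient-at-root a (b′ ∷ bs) qs≈0 q≈0
    where
    b≈0 : b ≈ 0#
    b≈0 = begin
      b                           ≈⟨ +-identityʳ b ⟨
      b + 0#                      ≈⟨ +-congˡ (trans (*-congˡ q≈0) (zeroʳ a)) ⟨
      b + a * evalP (b′ ∷ bs) a   ≈⟨ Pa≈0 ⟩
      0#                          ∎

  vanishing-at-distinct-points : ∀ (as P : List Carrier) → length as ≡ length P →
    AllPairs (λ a b → ¬ (a ≈ b)) as → All (λ a → evalP P a ≈ 0#) as → All (_≈ 0#) P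
  vanishing-at-distinct-points []       []       _   _                _              = []
  vanishing-at-distinct-points (a ∷ as) (b ∷ bs) len (a≉as ∷ distinct) (Pa≈0 ∷ Pas≈0) =
    zero-quotient-at-root a (b ∷ bs)
      (vanishing-at-distinct-points as Q
        (≡.trans (ℕ.suc-injective len) (≡.sym (length-quotient a b bs)))
        distinct (quotient-roots as a≉as Pas≈0))
      Pa≈0
    where
    open import Data.Nat.Properties as ℕ using (suc-injective)
    Q : List Carrier
    Q = quotient a (b ∷ bs)
    quotient-roots : ∀ cs → All (λ c → ¬ (a ≈ c)) cs → All (λ c → evalP (b ∷ bs) c ≈ 0#) cs →
                     All (λ c → evalP Q c ≈ 0#) cs
    quotient-roots []       []            []              = []
    quotient-roots (c ∷ cs) (a≉c ∷ a≉cs) (Pc≈0 ∷ Pcs≈0) =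
      x*y≈0⇒y≈0 c-a≉0 (begin
        (c - a) * evalP Q c                   ≈⟨ +-identityˡ _ ⟨
        0# + (c - a) * evalP Q c              ≈⟨ +-congʳ Pa≈0 ⟨
        evalP (b ∷ bs) a + (c - a) * evalP Q c ≈⟨ division-identity a c (b ∷ bs) ⟨
        evalP (b ∷ bs) c                      ≈⟨ Pc≈0 ⟩
        0#                                    ∎)
      ∷ quotient-roots cs a≉cs Pcs≈0
      where
      c-a≉0 : ¬ (c - a ≈ 0#)
      c-a≉0 c-a≈0 = a≉c (sym (begin
        c                ≈⟨ solve 2 (λ a c → c := (c :- a) :+ a) refl a c ⟩
        (c - a) + a      ≈⟨ +-congʳ c-a≈0 ⟩
        0# + a           ≈⟨ +-identityˡ a ⟩
        a                ∎))

-- Formal power series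

module PowerSeries {c ℓ} (R : CommutativeRing c ℓ) where
  open CommutativeRing R
  open RingOps R
  open RingArithmetic R
  open FiniteSums R
  open RingSolver using (solve; _:+_; _:*_; _:=_)
  open import Algebra.Properties.Ring ring using (-‿distribˡ-*; -‿+-comm; -0#≈0#)
  open import Relation.Binary.Reasoning.Setoid setoid

  Series : Set c
  Series = ℕ → Carrier

  infix 4 _≋_
  _≋_ : Series → Series → Set ℓ
  f ≋ g = ∀ k → f k ≈ g k

  infixl 6 _⊕_ _⊝_
  infixl 7 _⋆_
  infix 8 ⊝_

  _⊕_ : Series → Series → Series
  (f ⊕ g) k = f k + g k

  ⊝_ : Series → Series
  (⊝ f) k = - f k

  _⊝_ : Series → Series → Series
  f ⊝ g = f ⊕ ⊝ g

  _⋆_ : Series → Series → Series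
  (f ⋆ g) zero    = f 0 * g 0
  (f ⋆ g) (suc k) = f 0 * g (suc k) + ((f ∘ suc) ⋆ g) k

  δ : Series
  δ zero    = 1#
  δ (suc k) = 0#

  0ₛ : Series
  0ₛ _ = 0#

  ⋆-as-Σ : ∀ f g k → (f ⋆ g) k ≈ Σ (suc k) (λ i → f i * g (k ∸ i))
  ⋆-as-Σ f g zero    = sym (+-identityʳ _)
  ⋆-as-Σ f g (suc k) = +-congˡ (⋆-as-Σ (f ∘ suc) g k)

  ⋆-cong : ∀ {f f′ g g′} → f ≋ f′ → g ≋ g′ → f ⋆ g ≋ f′ ⋆ g′
  ⋆-cong f≋f′ g≋g′ zero    = *-cong (f≋f′ 0) (g≋g′ 0)
  ⋆-cong f≋f′ g≋g′ (suc k) = +-cong (*-cong (f≋f′ 0) (g≋g′ (suc k))) (⋆-cong (f≋f′ ∘ suc) g≋g′ k)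

  ⋆-congˡ-upTo : ∀ k {f f′} g → (∀ i → i ≤ k → f i ≈ f′ i) → (f ⋆ g) k ≈ (f′ ⋆ g) k
  ⋆-congˡ-upTo zero    g f≈f′ = *-congʳ (f≈f′ 0 z≤n)
  ⋆-congˡ-upTo (suc k) g f≈f′ =
    +-cong (*-congʳ (f≈f′ 0 z≤n)) (⋆-congˡ-upTo k g (λ i i≤k → f≈f′ (suc i) (s≤s i≤k)))

  ⋆-distribʳ-⊕ : ∀ h f g → (f ⊕ g) ⋆ h ≋ f ⋆ h ⊕ g ⋆ h
  ⋆-distribʳ-⊕ h f g zero    = distribʳ _ _ _
  ⋆-distribʳ-⊕ h f g (suc k) = trans (+-cong (distribʳ _ _ _) (⋆-distribʳ-⊕ h (f ∘ suc) (g ∘ suc) k)) (interchange _ _ _ _)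
    where open import Algebra.Properties.CommutativeSemigroup +-commutativeSemigroup using (interchange)

  ⋆-scaleˡ : ∀ a f g k → ((λ i → a * f i) ⋆ g) k ≈ a * (f ⋆ g) k
  ⋆-scaleˡ a f g zero    = *-assoc _ _ _
  ⋆-scaleˡ a f g (suc k) = trans (+-cong (*-assoc _ _ _) (⋆-scaleˡ a (f ∘ suc) g k)) (sym (distribˡ _ _ _))

  ⋆-negˡ : ∀ f g → (⊝ f) ⋆ g ≋ ⊝ (f ⋆ g)
  ⋆-negˡ f g zero    = sym (-‿distribˡ-* _ _)
  ⋆-negˡ f g (suc k) = trans (+-cong (sym (-‿distribˡ-* _ _)) (⋆-negˡ (f ∘ suc) g k)) (-‿+-comm _ _)

  ⋆-zeroˡ : ∀ g → 0ₛ ⋆ g ≋ 0ₛ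
  ⋆-zeroˡ g zero    = zeroˡ _
  ⋆-zeroˡ g (suc k) = trans (+-cong (zeroˡ _) (⋆-zeroˡ g k)) (+-identityˡ _)

  ⋆-identityˡ : ∀ g → δ ⋆ g ≋ g
  ⋆-identityˡ g zero    = *-identityˡ _
  ⋆-identityˡ g (suc k) = trans (+-cong (*-identityˡ _) (⋆-zeroˡ g k)) (+-identityʳ _)

  ⋆-last : ∀ f g k → (f ⋆ g) (suc k) ≈ (f ⋆ (g ∘ suc)) k + f (suc k) * g 0
  ⋆-last f g zero    = refl
  ⋆-last f g (suc k) = trans (+-congˡ (⋆-last (f ∘ suc) g k)) (sym (+-assoc _ _ _))

  ⋆-comm : ∀ f g → f ⋆ g ≋ g ⋆ f
  ⋆-comm f g zero    = *-comm _ _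
  ⋆-comm f g (suc k) = begin
    f 0 * g (suc k) + ((f ∘ suc) ⋆ g) k   ≈⟨ +-cong (*-comm _ _) (⋆-comm (f ∘ suc) g k) ⟩
    g (suc k) * f 0 + (g ⋆ (f ∘ suc)) k   ≈⟨ +-comm _ _ ⟩
    (g ⋆ (f ∘ suc)) k + g (suc k) * f 0   ≈⟨ ⋆-last g f k ⟨
    (g ⋆ f) (suc k)                        ∎

  ⋆-scaleʳ : ∀ a f g k → (f ⋆ (λ i → a * g i)) k ≈ a * (f ⋆ g) k
  ⋆-scaleʳ a f g k = trans (⋆-comm f _ k) (trans (⋆-scaleˡ a g f k) (*-congˡ (⋆-comm g f k)))

  ⋆-assoc : ∀ f g h → (f ⋆ g) ⋆ h ≋ f ⋆ (g ⋆ h)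
  ⋆-assoc f g h zero    = *-assoc _ _ _
  ⋆-assoc f g h (suc k) = begin
    (f ⋆ g) 0 * h (suc k) + ((λ i → f 0 * g (suc i) + ((f ∘ suc) ⋆ g) i) ⋆ h) k
      ≈⟨ +-congˡ (⋆-distribʳ-⊕ h (λ i → f 0 * g (suc i)) ((f ∘ suc) ⋆ g) k) ⟩
    (f ⋆ g) 0 * h (suc k) + (((λ i → f 0 * g (suc i)) ⋆ h) k + (((f ∘ suc) ⋆ g) ⋆ h) k)
      ≈⟨ +-congˡ (+-cong (⋆-scaleˡ (f 0) (g ∘ suc) h k) (⋆-assoc (f ∘ suc) g h k)) ⟩
    (f 0 * g 0) * h (suc k) + (f 0 * ((g ∘ suc) ⋆ h) k + ((f ∘ suc) ⋆ (g ⋆ h)) k)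
      ≈⟨ solve 5 (λ a b c d e → (a :* b) :* c :+ (a :* d :+ e) := a :* (b :* c :+ d) :+ e) refl _ _ _ _ _ ⟩
    f 0 * (g ⋆ h) (suc k) + ((f ∘ suc) ⋆ (g ⋆ h)) k ∎

  ⋆-distribˡ-⊕ : ∀ f g g′ → f ⋆ (g ⊕ g′) ≋ f ⋆ g ⊕ f ⋆ g′
  ⋆-distribˡ-⊕ f g g′ k = trans (⋆-comm f _ k) (trans (⋆-distribʳ-⊕ f g g′ k) (+-cong (⋆-comm g f k) (⋆-comm g′ f k)))

  ⋆-unit-cancelʳ : ∀ f g → g 0 ≈ 1# → f ⋆ g ≋ 0ₛ → f ≋ 0ₛ
  ⋆-unit-cancelʳ f g g₀≈1 f⋆g≋0 k = below (suc k) k ℕ.≤-refl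
    where
    below : ∀ M k → k < M → f k ≈ 0#
    below (suc M) zero    _         = trans (sym (trans (*-congˡ g₀≈1) (*-identityʳ _))) (f⋆g≋0 0)
    below (suc M) (suc k) (s≤s k<M) = begin
      f (suc k)                                 ≈⟨ trans (*-congˡ g₀≈1) (*-identityʳ _) ⟨
      f (suc k) * g 0                           ≈⟨ +-identityˡ _ ⟨
      0# + f (suc k) * g 0
        ≈⟨ +-congʳ (trans (⋆-congˡ-upTo k (g ∘ suc) (λ i i≤k → below M i (ℕ.≤-<-trans i≤k k<M))) (⋆-zeroˡ (g ∘ suc) k)) ⟨
      (f ⋆ (g ∘ suc)) k + f (suc k) * g 0       ≈⟨ ⋆-last f g k ⟨
      (f ⋆ g) (suc k)                           ≈⟨ f⋆g≋0 (suc k) ⟩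
      0#                                        ∎

  series-ring : CommutativeRing c ℓ
  series-ring = record
    { Carrier = Series
    ; _≈_ = _≋_
    ; _+_ = _⊕_
    ; _*_ = _⋆_
    ; -_ = ⊝_
    ; 0# = 0ₛ
    ; 1# = δ
    ; isCommutativeRing = record
      { isRing = record
        { +-isAbelianGroup = record
          { isGroup = record
            { isMonoid = record
              { isSemigroup = record
                { isMagma = record
                  { isEquivalence = record
                    { refl = λ _ → refl ; sym = λ p k → sym (p k) ; trans = λ p q k → trans (p k) (q k) }
                  ; ∙-cong = λ p q k → +-cong (p k) (q k) }
                ; assoc = λ f g h k → +-assoc _ _ _ }
              ; identity = (λ f k → +-identityˡ _) , (λ f k → +-identityʳ _) }
            ; inverse = (λ f k → -‿inverseˡ _) , (λ f k → -‿inverseʳ _)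
            ; ⁻¹-cong = λ p k → -‿cong (p k) }
          ; comm = λ f g k → +-comm _ _ }
        ; *-cong = ⋆-cong
        ; *-assoc = ⋆-assoc
        ; *-identity = ⋆-identityˡ , (λ f k → trans (⋆-comm f δ k) (⋆-identityˡ f k))
        ; distrib = ⋆-distribˡ-⊕ , ⋆-distribʳ-⊕ }
      ; *-comm = ⋆-comm } }

  open RingOps series-ring public using () renaming (pow to powₛ; natR to natRₛ)

  X : Series
  X zero          = 0#
  X (suc zero)    = 1#
  X (suc (suc _)) = 0#

  X⋆-zero : ∀ f → (X ⋆ f) 0 ≈ 0#
  X⋆-zero f = zeroˡ _

  X⋆-suc : ∀ f k → (X ⋆ f) (suc k) ≈ f k
  X⋆-suc f k = trans (+-cong (zeroˡ _) (trans (⋆-cong X∘suc≋δ (λ _ → refl) k) (⋆-identityˡ f k))) (+-identityˡ _)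
    where
    X∘suc≋δ : X ∘ suc ≋ δ
    X∘suc≋δ zero    = refl
    X∘suc≋δ (suc i) = refl

  natRₛ≋ : ∀ m → natRₛ m ≋ (λ i → natR m * δ i)
  natRₛ≋ zero    i = sym (zeroˡ _)
  natRₛ≋ (suc m) i = trans (+-congˡ (natRₛ≋ m i)) (sym (trans (distribʳ _ _ _) (+-congʳ (*-identityˡ _))))

  natRₛ⋆ : ∀ m f k → (natRₛ m ⋆ f) k ≈ natR m * f k
  natRₛ⋆ m f k = trans (⋆-cong (natRₛ≋ m) (λ _ → refl) k) (trans (⋆-scaleˡ (natR m) δ f k) (*-congˡ (⋆-identityˡ f k)))

  binomial-series : ∀ m → powₛ (δ ⊕ X) m ≋ (λ k → natR (m C k))
  binomial-series zero    zero    = sym (+-identityʳ 1#)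
  binomial-series zero    (suc k) = refl
  binomial-series (suc m) k = trans (⋆-distribʳ-⊕ (powₛ (δ ⊕ X) m) δ X k) (trans (+-congʳ (⋆-identityˡ _ k)) (pascal k))
    where
    pascal : ∀ k → powₛ (δ ⊕ X) m k + (X ⋆ powₛ (δ ⊕ X) m) k ≈ natR (suc m C k)
    pascal zero    = trans (+-cong (binomial-series m 0) (X⋆-zero (powₛ (δ ⊕ X) m))) (+-identityʳ _)
    pascal (suc j) = begin
      powₛ (δ ⊕ X) m (suc j) + (X ⋆ powₛ (δ ⊕ X) m) (suc j)
        ≈⟨ +-cong (binomial-series m (suc j)) (trans (X⋆-suc _ j) (binomial-series m j)) ⟩
      natR (m C suc j) + natR (m C j)       ≈⟨ +-comm _ _ ⟩
      natR (m C j) + natR (m C suc j)       ≈⟨ natR-homo-+ (m C j) (m C suc j) ⟨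
      natR (m C j ℕ.+ m C suc j)            ≡⟨ ≡.cong natR (nCk+nC[k+1]≡[n+1]C[k+1] m j) ⟩
      natR (suc m C suc j)                  ∎

  alternating-binomial-series : ∀ m → powₛ (δ ⊝ X) m ≋ (λ k → sgn k * natR (m C k))
  alternating-binomial-series zero    zero    = sym (trans (*-identityˡ _) (+-identityʳ 1#))
  alternating-binomial-series zero    (suc k) = sym (zeroʳ _)
  alternating-binomial-series (suc m) k =
    trans (⋆-distribʳ-⊕ (powₛ (δ ⊝ X) m) δ (⊝ X) k)
          (trans (+-cong (⋆-identityˡ _ k) (⋆-negˡ X _ k)) (pascal k))
    where
    P : Series
    P = powₛ (δ ⊝ X) m
    pascal : ∀ k → P k - (X ⋆ P) k ≈ sgn k * natR (suc m C k)
    pascal zero    = trans (+-cong (alternating-binomial-series m 0) (trans (-‿cong (X⋆-zero P)) -0#≈0#)) (+-identityʳ _)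
    pascal (suc j) = begin
      P (suc j) - (X ⋆ P) (suc j)
        ≈⟨ +-cong (alternating-binomial-series m (suc j)) (-‿cong (trans (X⋆-suc P j) (alternating-binomial-series m j))) ⟩
      sgn (suc j) * natR (m C suc j) - sgn j * natR (m C j)
        ≈⟨ +-congʳ (*-congʳ (sgn-suc j)) ⟩
      - sgn j * natR (m C suc j) - sgn j * natR (m C j)
        ≈⟨ solve 3 (λ s a b → :- s :* a :- s :* b := (:- s) :* (b :+ a)) refl (sgn j) _ _ ⟩
      - sgn j * (natR (m C j) + natR (m C suc j))
        ≈⟨ *-cong (sym (sgn-suc j)) (sym (natR-homo-+ (m C j) (m C suc j))) ⟩
      sgn (suc j) * natR (m C j ℕ.+ m C suc j)
        ≡⟨ ≡.cong (λ c → sgn (suc j) * natR c) (nCk+nC[k+1]≡[n+1]C[k+1] m j) ⟩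
      sgn (suc j) * natR (suc m C suc j) ∎
      where open RingSolver using (:-_; _:-_)

  alternate : Series → Series
  alternate f k = sgn k * f k

  alternate-⋆ : ∀ f g → alternate f ⋆ alternate g ≋ alternate (f ⋆ g)
  alternate-⋆ f g zero    = trans (*-cong (*-identityˡ _) (*-identityˡ _)) (sym (*-identityˡ _))
  alternate-⋆ f g (suc k) = begin
    (1# * f 0) * (sgn (suc k) * g (suc k)) + ((alternate f ∘ suc) ⋆ alternate g) k
      ≈⟨ +-congˡ (⋆-cong {g′ = alternate g} (λ t → trans (*-congʳ (sgn-suc t)) (sym (-‿distribˡ-* _ _))) (λ _ → refl) k) ⟩
    (1# * f 0) * (sgn (suc k) * g (suc k)) + ((⊝ alternate (f ∘ suc)) ⋆ alternate g) k
      ≈⟨ +-congˡ (trans (⋆-negˡ (alternate (f ∘ suc)) (alternate g) k) (-‿cong (alternate-⋆ (f ∘ suc) g k))) ⟩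
    (1# * f 0) * (sgn (suc k) * g (suc k)) - sgn k * ((f ∘ suc) ⋆ g) k
      ≈⟨ +-congʳ (*-congˡ (*-congʳ (sgn-suc k))) ⟩
    (1# * f 0) * (- sgn k * g (suc k)) - sgn k * ((f ∘ suc) ⋆ g) k
      ≈⟨ solve 4 (λ a s b c → (a) :* ((:- s) :* b) :- s :* c := (:- s) :* (a :* b :+ c)) refl (1# * f 0) (sgn k) (g (suc k)) _ ⟩
    - sgn k * (1# * f 0 * g (suc k) + ((f ∘ suc) ⋆ g) k)
      ≈⟨ *-cong (sym (sgn-suc k)) (+-congʳ (*-congʳ (*-identityˡ _))) ⟩
    sgn (suc k) * (f ⋆ g) (suc k) ∎
    where open RingSolver using (:-_; _:-_)

  X/[1-X] : Series
  X/[1-X] zero    = 0#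
  X/[1-X] (suc _) = 1#

  X/[1-X]⋆-zero : ∀ f → (X/[1-X] ⋆ f) 0 ≈ 0#
  X/[1-X]⋆-zero f = zeroˡ _

  X/[1-X]⋆-suc : ∀ f k → (X/[1-X] ⋆ f) (suc k) ≈ Σ (suc k) f
  X/[1-X]⋆-suc f k = trans (+-cong (zeroˡ _) (partial-sums k f)) (+-identityˡ _)
    where
    partial-sums : ∀ k f → ((λ _ → 1#) ⋆ f) k ≈ Σ (suc k) f
    partial-sums zero    f = trans (*-identityˡ _) (sym (+-identityʳ _))
    partial-sums (suc k) f = begin
      1# * f (suc k) + ((λ _ → 1#) ⋆ f) k   ≈⟨ +-cong (*-identityˡ _) (partial-sums k f) ⟩
      f (suc k) + Σ (suc k) f               ≈⟨ +-comm _ _ ⟩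
      Σ (suc k) f + f (suc k)               ≈⟨ Σ-snoc (suc k) f ⟨
      Σ (suc (suc k)) f                     ∎

  X/[1-X]⋆[1-X] : X/[1-X] ⋆ (δ ⊝ X) ≋ X
  X/[1-X]⋆[1-X] zero          = X/[1-X]⋆-zero (δ ⊝ X)
  X/[1-X]⋆[1-X] (suc zero)    = trans (X/[1-X]⋆-suc (δ ⊝ X) 0) (trans (+-identityʳ _) (trans (+-congˡ -0#≈0#) (+-identityʳ _)))
  X/[1-X]⋆[1-X] (suc (suc k)) = begin
    (X/[1-X] ⋆ (δ ⊝ X)) (suc (suc k))            ≈⟨ X/[1-X]⋆-suc (δ ⊝ X) (suc k) ⟩
    (1# - 0#) + ((0# - 1#) + Σ k (λ _ → 0# - 0#)) ≈⟨ +-congˡ (+-congˡ (Σ-zero k _ (λ _ _ → -‿inverseʳ 0#))) ⟩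
    (1# - 0#) + ((0# - 1#) + 0#)                 ≈⟨ solve 0 ((con (+ 1) :- con (+ 0)) :+ ((con (+ 0) :- con (+ 1)) :+ con (+ 0)) := con (+ 0)) refl ⟩
    0#                                           ∎
    where
    open RingSolver using (_:-_; con)
    open import Data.Integer using (+_)

module SeriesSubstitution {c ℓ} (R : CommutativeRing c ℓ) where
  open CommutativeRing R
  open RingOps R
  open RingArithmetic R
  open FiniteSums R
  open PowerSeries R
  open import Relation.Binary.Reasoning.Setoid setoid

  -- subst-coeff M j = C(M-1, j-1) is the coefficient of X^M in (X / (1 - X))^j.
  subst-coeff : ℕ → ℕ → ℕ
  subst-coeff zero    zero    = 1
  subst-coeff zero    (suc j) = 0
  subst-coeff (suc M) zero    = 0
  subst-coeff (suc M) (suc j) = M C j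

  subst-coeff-vanishes : ∀ M j → M < j → subst-coeff M j ≡ 0
  subst-coeff-vanishes zero    (suc j) _         = ≡.refl
  subst-coeff-vanishes (suc M) (suc j) (s≤s M<j) = k>n⇒nCk≡0 M<j

  hockey-stick : ∀ M j → Σ (suc M) (λ k → natR (subst-coeff k j)) ≈ natR (M C j)
  hockey-stick zero    zero    = +-identityʳ _
  hockey-stick zero    (suc j) = +-identityʳ _
  hockey-stick (suc M) j = trans (Σ-snoc (suc M) (λ k → natR (subst-coeff k j))) (trans (+-congʳ (hockey-stick M j)) (pascal j))
    where
    pascal : ∀ j → natR (M C j) + natR (subst-coeff (suc M) j) ≈ natR (suc M C j)
    pascal zero    = +-identityʳ _
    pascal (suc j) = trans (sym (natR-homo-+ (M C suc j) (M C j)))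
      (reflexive (≡.cong natR (≡.trans (ℕ.+-comm (M C suc j) (M C j)) (nCk+nC[k+1]≡[n+1]C[k+1] M j))))

  subst-term : Series → ℕ → ℕ → Carrier
  subst-term f M j = natR (subst-coeff M j) * f j

  -- substitute f = f (X / (1 - X))
  substitute : Series → Series
  substitute f M = Σ (suc M) (subst-term f M)

  substitute-zero : ∀ f → substitute f 0 ≈ f 0
  substitute-zero f = trans (+-identityʳ _) (trans (*-congʳ (+-identityʳ 1#)) (*-identityˡ _))

  substitute-cong : ∀ {f g} → f ≋ g → substitute f ≋ substitute g
  substitute-cong {f} {g} f≋g M = Σ-cong (suc M) {subst-term f M} {subst-term g M} (λ j → *-congˡ (f≋g j))

  substitute-⊕ : ∀ f g → substitute (f ⊕ g) ≋ substitute f ⊕ substitute g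
  substitute-⊕ f g M =
    trans (Σ-cong (suc M) (λ j → distribˡ (natR (subst-coeff M j)) (f j) (g j)))
          (Σ-distrib-+ (suc M) (subst-term f M) (subst-term g M))

  substitute-scale : ∀ a f → substitute (λ i → a * f i) ≋ (λ k → a * substitute f k)
  substitute-scale a f M =
    trans (Σ-cong (suc M) (λ j → x*[a*y]≈a*[x*y] (natR (subst-coeff M j)) a (f j)))
          (sym (*-distribˡ-Σ (suc M) a (subst-term f M)))
    where
    x*[a*y]≈a*[x*y] : ∀ x a y → x * (a * y) ≈ a * (x * y)
    x*[a*y]≈a*[x*y] x a y = trans (sym (*-assoc x a y)) (trans (*-congʳ (*-comm x a)) (*-assoc a x y))

  substitute-⊝ : ∀ f → substitute (⊝ f) ≋ ⊝ substitute f
  substitute-⊝ f M =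
    trans (Σ-cong (suc M) (λ j → sym (-‿distribʳ-* (natR (subst-coeff M j)) (f j))))
          (sym (-‿distrib-Σ (suc M) (subst-term f M)))
    where open import Algebra.Properties.Ring ring using (-‿distribʳ-*)

  substitute-δ : substitute δ ≋ δ
  substitute-δ zero    = substitute-zero δ
  substitute-δ (suc M) = trans (+-cong (zeroˡ _) (Σ-zero (suc M) (λ j → natR (M C j) * 0#) (λ j _ → zeroʳ _))) (+-identityʳ _)

  substitute-X : substitute X ≋ X/[1-X]
  substitute-X zero    = substitute-zero X
  substitute-X (suc M) = begin
    natR 0 * 0# + (natR 1 * 1# + Σ M (λ j → natR (M C suc j) * 0#))
      ≈⟨ +-cong (zeroˡ _) (+-cong (trans (*-identityʳ _) (+-identityʳ 1#)) (Σ-zero M _ (λ j _ → zeroʳ _))) ⟩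
    0# + (1# + 0#)   ≈⟨ trans (+-identityˡ _) (+-identityʳ _) ⟩
    1#               ∎

  substitute-unfold : ∀ f → substitute f ≋ (λ k → f 0 * δ k) ⊕ X/[1-X] ⋆ substitute (f ∘ suc)
  substitute-unfold f zero    = trans (substitute-zero f) (sym (trans (+-cong (*-identityʳ _) (X/[1-X]⋆-zero (substitute (f ∘ suc)))) (+-identityʳ _)))
  substitute-unfold f (suc M) = begin
    natR 0 * f 0 + Σ (suc M) (λ j → natR (M C j) * f (suc j))
      ≈⟨ trans (+-congʳ (zeroˡ _)) (+-identityˡ _) ⟩
    Σ (suc M) (λ j → natR (M C j) * f (suc j))
      ≈⟨ Σ-cong (suc M) {g = λ j → Σ (suc M) (λ k → natR (subst-coeff k j)) * f (suc j)} (λ j → *-congʳ (sym (hockey-stick M j))) ⟩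
    Σ (suc M) (λ j → Σ (suc M) (λ k → natR (subst-coeff k j)) * f (suc j))
      ≈⟨ Σ-cong (suc M) (λ j → *-distribʳ-Σ (suc M) (f (suc j)) (λ k → natR (subst-coeff k j))) ⟩
    Σ (suc M) (λ j → Σ (suc M) (λ k → subst-term (f ∘ suc) k j))
      ≈⟨ Σ-swap (suc M) (suc M) (λ j k → subst-term (f ∘ suc) k j) ⟩
    Σ (suc M) (λ k → Σ (suc M) (subst-term (f ∘ suc) k))
      ≈⟨ Σ-cong< (suc M) truncate ⟩
    Σ (suc M) (substitute (f ∘ suc))
      ≈⟨ X/[1-X]⋆-suc _ M ⟨
    (X/[1-X] ⋆ substitute (f ∘ suc)) (suc M)
      ≈⟨ trans (+-congʳ (zeroʳ _)) (+-identityˡ _) ⟨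
    f 0 * 0# + (X/[1-X] ⋆ substitute (f ∘ suc)) (suc M) ∎
    where
    truncate : ∀ k → k < suc M → Σ (suc M) (subst-term (f ∘ suc) k) ≈ substitute (f ∘ suc) k
    truncate k (s≤s k≤M) = begin
      Σ (suc M) (subst-term (f ∘ suc) k)
        ≡⟨ ≡.cong (λ m → Σ m (subst-term (f ∘ suc) k)) (≡.cong suc (ℕ.m+[n∸m]≡n k≤M)) ⟨
      Σ (suc k ℕ.+ (M ∸ k)) (subst-term (f ∘ suc) k)
        ≈⟨ Σ-vanishing-tail (suc k) (M ∸ k) (subst-term (f ∘ suc) k)
             (λ j k<j → trans (*-congʳ (reflexive (≡.cong natR (subst-coeff-vanishes k j k<j)))) (zeroˡ _)) ⟩
      substitute (f ∘ suc) k ∎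

  substitute-⋆ : ∀ f g → substitute (f ⋆ g) ≋ substitute f ⋆ substitute g
  substitute-⋆ f g k = below (suc k) f g k ℕ.≤-refl
    where
    below : ∀ M f g k → k < M → substitute (f ⋆ g) k ≈ (substitute f ⋆ substitute g) k
    below (suc M) f g zero    _         = trans (substitute-zero (f ⋆ g)) (sym (*-cong (substitute-zero f) (substitute-zero g)))
    below (suc M) f g (suc k) (s≤s k<M) = begin
      substitute (f ⋆ g) (suc k)
        ≈⟨ substitute-unfold (f ⋆ g) (suc k) ⟩
      (f ⋆ g) 0 * 0# + (X/[1-X] ⋆ substitute ((f ⋆ g) ∘ suc)) (suc k)
        ≈⟨ trans (+-congʳ (zeroʳ _)) (+-identityˡ _) ⟩
      (X/[1-X] ⋆ substitute ((f ⋆ g) ∘ suc)) (suc k)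
        ≈⟨ ⋆-cong {X/[1-X]} (λ _ → refl)
             (λ i → trans (substitute-⊕ (λ j → f 0 * g (suc j)) ((f ∘ suc) ⋆ g) i) (+-congʳ (substitute-scale (f 0) (g ∘ suc) i))) (suc k) ⟩
      (X/[1-X] ⋆ (λ i → f 0 * substitute (g ∘ suc) i + substitute ((f ∘ suc) ⋆ g) i)) (suc k)
        ≈⟨ X/[1-X]⋆-suc _ k ⟩
      Σ (suc k) (λ i → f 0 * substitute (g ∘ suc) i + substitute ((f ∘ suc) ⋆ g) i)
        ≈⟨ Σ-cong< (suc k) {g = λ i → f 0 * substitute (g ∘ suc) i + (substitute (f ∘ suc) ⋆ substitute g) i}
             (λ i i≤k → +-congˡ (below M (f ∘ suc) g i (ℕ.<-≤-trans i≤k k<M))) ⟩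
      Σ (suc k) (λ i → f 0 * substitute (g ∘ suc) i + (substitute (f ∘ suc) ⋆ substitute g) i)
        ≈⟨ X/[1-X]⋆-suc _ k ⟨
      (X/[1-X] ⋆ ((λ i → f 0 * substitute (g ∘ suc) i) ⊕ substitute (f ∘ suc) ⋆ substitute g)) (suc k)
        ≈⟨ ⋆-distribˡ-⊕ X/[1-X] _ _ (suc k) ⟩
      (X/[1-X] ⋆ (λ i → f 0 * substitute (g ∘ suc) i)) (suc k) + (X/[1-X] ⋆ (substitute (f ∘ suc) ⋆ substitute g)) (suc k)
        ≈⟨ +-cong (⋆-scaleʳ (f 0) X/[1-X] _ (suc k)) (sym (⋆-assoc X/[1-X] _ _ (suc k))) ⟩
      f 0 * (X/[1-X] ⋆ substitute (g ∘ suc)) (suc k) + ((X/[1-X] ⋆ substitute (f ∘ suc)) ⋆ substitute g) (suc k)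
        ≈⟨ +-congʳ (*-congˡ (trans (sym (+-identityˡ _)) (trans (+-congʳ (sym (zeroʳ (g 0)))) (sym (substitute-unfold g (suc k)))))) ⟩
      f 0 * substitute g (suc k) + ((X/[1-X] ⋆ substitute (f ∘ suc)) ⋆ substitute g) (suc k)
        ≈⟨ +-congʳ (trans (⋆-scaleˡ (f 0) δ (substitute g) (suc k)) (*-congˡ (⋆-identityˡ _ (suc k)))) ⟨
      ((λ i → f 0 * δ i) ⋆ substitute g) (suc k) + ((X/[1-X] ⋆ substitute (f ∘ suc)) ⋆ substitute g) (suc k)
        ≈⟨ ⋆-distribʳ-⊕ (substitute g) (λ i → f 0 * δ i) (X/[1-X] ⋆ substitute (f ∘ suc)) (suc k) ⟨
      (((λ i → f 0 * δ i) ⊕ X/[1-X] ⋆ substitute (f ∘ suc)) ⋆ substitute g) (suc k)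
        ≈⟨ ⋆-cong (substitute-unfold f) (λ _ → refl) (suc k) ⟨
      (substitute f ⋆ substitute g) (suc k) ∎

  substitute-natRₛ : ∀ m → substitute (natRₛ m) ≋ natRₛ m
  substitute-natRₛ zero    M = Σ-zero (suc M) (subst-term 0ₛ M) (λ j _ → zeroʳ _)
  substitute-natRₛ (suc m) M = trans (substitute-⊕ δ (natRₛ m) M) (+-cong (substitute-δ M) (substitute-natRₛ m M))

  substitute-powₛ : ∀ f m → substitute (powₛ f m) ≋ powₛ (substitute f) m
  substitute-powₛ f zero      = substitute-δ
  substitute-powₛ f (suc m) M = trans (substitute-⋆ f (powₛ f m) M) (⋆-cong {substitute f} (λ _ → refl) (substitute-powₛ f m) M)

-- Roots of unity and symmetric functions

module BinomialQuotient {c ℓ} (K : Char0Field c ℓ) (N : ℕ) where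
  open Char0Field K
  open RingArithmetic cring
  open FieldArithmetic K

  n : ℕ
  n = suc N

  n≉0 : ¬ (natR n ≈ 0#)
  n≉0 = char0 N

  ê : ℕ → Carrier
  ê k = natR (n C suc k) * natR n ⁻¹

  n*ê : ∀ k → natR n * ê k ≈ natR (n C suc k)
  n*ê k = trans (trans (sym (*-assoc _ _ _)) (*-congʳ (*-comm _ _)))
               (trans (*-assoc _ _ _) (trans (*-congˡ (⁻¹-inverse _ n≉0)) (*-identityʳ _)))

  ê-zero : ê 0 ≈ 1#
  ê-zero = trans (*-congʳ (reflexive (≡.cong natR (nC1≡n n)))) (⁻¹-inverse _ n≉0)

  [1+k]*ê≈NCk : ∀ k → natR (suc k) * ê k ≈ natR (N C k)
  [1+k]*ê≈NCk k = begin
    natR (suc k) * (natR (n C suc k) * natR n ⁻¹)    ≈⟨ *-assoc _ _ _ ⟨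
    (natR (suc k) * natR (n C suc k)) * natR n ⁻¹    ≈⟨ *-congʳ (natR-homo-* (suc k) (n C suc k)) ⟨
    natR (suc k ℕ.* (n C suc k)) * natR n ⁻¹         ≡⟨ ≡.cong (λ z → natR z * natR n ⁻¹) ([1+k]*[1+n]C[1+k]≡[1+n]*nCk N k) ⟩
    natR (n ℕ.* (N C k)) * natR n ⁻¹                 ≈⟨ *-congʳ (trans (natR-homo-* n (N C k)) (*-comm _ _)) ⟩
    (natR (N C k) * natR n) * natR n ⁻¹              ≈⟨ *-assoc _ _ _ ⟩
    natR (N C k) * (natR n * natR n ⁻¹)              ≈⟨ trans (*-congˡ (⁻¹-inverse _ n≉0)) (*-identityʳ _) ⟩
    natR (N C k)                                     ∎
    where open import Relation.Binary.Reasoning.Setoid setoid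

module RootsOfUnity {c ℓ} (K : Char0Field c ℓ) (N : ℕ) (ζ : Char0Field.Carrier K)
                    (ζ-primitive : Char0Field.IsPrimitiveRoot K (suc N) ζ) where
  open Char0Field K
  open RingArithmetic cring
  open FiniteSums cring
  open FieldArithmetic K
  open PolynomialRoots K
  open BinomialQuotient K N
  open RingSolver using (solve; _:+_; _:*_; _:-_; _:=_; con)
  open import Data.Integer using (+_)
  open import Relation.Binary.Reasoning.Setoid setoid

  ζ^n≈1 : pow ζ n ≈ 1#
  ζ^n≈1 = proj₁ ζ-primitive

  ζ^k≉1 : ∀ k → 1 ≤ k → k < n → ¬ (pow ζ k ≈ 1#)
  ζ^k≉1 = proj₂ ζ-primitive

  ζ^k≉0 : ∀ k → ¬ (pow ζ k ≈ 0#)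
  ζ^k≉0 zero    = 1#≉0#
  ζ^k≉0 (suc k) = *-≉0 ζ≉0 (ζ^k≉0 k)
    where
    ζ≉0 : ¬ (ζ ≈ 0#)
    ζ≉0 ζ≈0 = 1#≉0# (trans (sym ζ^n≈1) (trans (*-congʳ ζ≈0) (zeroˡ _)))

  ζ^-injective : ∀ i j → i < j → j < n → ¬ (pow ζ j ≈ pow ζ i)
  ζ^-injective i j i<j j<n ζʲ≈ζⁱ =
    ζ^k≉1 (j ∸ i) (ℕ.m<n⇒0<n∸m i<j) (ℕ.≤-<-trans (ℕ.m∸n≤m j i) j<n) (*-cancelˡ (ζ^k≉0 i) (begin
      pow ζ i * pow ζ (j ∸ i)   ≈⟨ pow-homo-+ ζ i (j ∸ i) ⟨
      pow ζ (i ℕ.+ (j ∸ i))     ≡⟨ ≡.cong (pow ζ) (ℕ.m+[n∸m]≡n (ℕ.<⇒≤ i<j)) ⟩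
      pow ζ j                   ≈⟨ ζʲ≈ζⁱ ⟩
      pow ζ i                   ≈⟨ *-identityʳ _ ⟨
      pow ζ i * 1#              ∎))

  x : ℕ → Carrier
  x i = (1# - pow ζ i) ⁻¹

  [1-ζ^i]*x≈1 : ∀ i → 1 ≤ i → i < n → (1# - pow ζ i) * x i ≈ 1#
  [1-ζ^i]*x≈1 i 1≤i i<n = ⁻¹-inverse _ 1-ζ^i≉0
    where
    1-ζ^i≉0 : ¬ (1# - pow ζ i ≈ 0#)
    1-ζ^i≉0 1-ζ^i≈0 = ζ^k≉1 i 1≤i i<n (sym (begin
      1#                        ≈⟨ solve 2 (λ a b → a := (a :- b) :+ b) refl 1# (pow ζ i) ⟩
      (1# - pow ζ i) + pow ζ i  ≈⟨ +-congʳ 1-ζ^i≈0 ⟩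
      0# + pow ζ i              ≈⟨ +-identityˡ _ ⟩
      pow ζ i                   ∎))

  Z : ℕ → List ℕ → Carrier
  Z lo ss = zsumFrom n ζ lo ss

  Z-as-Σ : ∀ lo s ss → Z lo (s ∷ ss) ≈ Σ (n ∸ lo) (λ i → pow (x (lo ℕ.+ i)) s * Z (suc (lo ℕ.+ i)) ss)
  Z-as-Σ lo s ss = begin
    sumR (map term (map (lo ℕ.+_) (upTo (n ∸ lo))))   ≡⟨ ≡.cong sumR (List.map-∘ (upTo (n ∸ lo))) ⟨
    sumR (map (term ∘ (lo ℕ.+_)) (upTo (n ∸ lo)))     ≈⟨ sumR-map-upTo (n ∸ lo) (term ∘ (lo ℕ.+_)) ⟩
    Σ (n ∸ lo) (term ∘ (lo ℕ.+_))                     ∎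
    where
    term : ℕ → Carrier
    term i = pow (x i) s * Z (suc i) ss

  Z-step : ∀ lo s ss → lo ≤ N → Z lo (s ∷ ss) ≈ pow (x lo) s * Z (suc lo) ss + Z (suc lo) (s ∷ ss)
  Z-step lo s ss lo≤N = begin
    Z lo (s ∷ ss)                                                   ≈⟨ Z-as-Σ lo s ss ⟩
    Σ (n ∸ lo) (λ i → term (lo ℕ.+ i))                              ≡⟨ ≡.cong (λ m → Σ m (λ i → term (lo ℕ.+ i))) (ℕ.+-∸-assoc 1 lo≤N) ⟩
    term (lo ℕ.+ 0) + Σ (N ∸ lo) (λ i → term (lo ℕ.+ suc i))
      ≈⟨ +-cong (reflexive (≡.cong term (ℕ.+-identityʳ lo))) (Σ-cong (N ∸ lo) (λ i → reflexive (≡.cong term (ℕ.+-suc lo i)))) ⟩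
    term lo + Σ (N ∸ lo) (λ i → term (suc lo ℕ.+ i))               ≈⟨ +-congˡ (Z-as-Σ (suc lo) s ss) ⟨
    term lo + Z (suc lo) (s ∷ ss)                                   ∎
    where
    term : ℕ → Carrier
    term i = pow (x i) s * Z (suc i) ss

  Z-beyond : ∀ lo s ss → N < lo → Z lo (s ∷ ss) ≈ 0#
  Z-beyond lo s ss N<lo = trans (Z-as-Σ lo s ss)
    (reflexive (≡.cong (λ m → Σ m (λ i → pow (x (lo ℕ.+ i)) s * Z (suc (lo ℕ.+ i)) ss)) (ℕ.m≤n⇒m∸n≡0 N<lo)))

  ones : ℕ → List ℕ
  ones k = applyUpTo (λ _ → 1) k

  -- e k lo is the k-th elementary symmetric function of x lo, …, x N.
  e : ℕ → ℕ → Carrier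
  e k lo = Z lo (ones k)

  e-step : ∀ k lo → lo ≤ N → e (suc k) lo ≈ x lo * e k (suc lo) + e (suc k) (suc lo)
  e-step k lo lo≤N = trans (Z-step lo 1 (ones k) lo≤N) (+-congʳ (*-congʳ (*-identityʳ _)))

  e-vanishes : ∀ lo k → n ∸ lo < k → e k lo ≈ 0#
  e-vanishes = downward-induction N (λ lo → ∀ k → n ∸ lo < k → e k lo ≈ 0#) above step
    where
    above : ∀ lo → N < lo → ∀ k → n ∸ lo < k → e k lo ≈ 0#
    above lo N<lo (suc k) _ = Z-beyond lo 1 (ones k) N<lo
    step : ∀ lo → lo ≤ N → (∀ k → n ∸ suc lo < k → e k (suc lo) ≈ 0#) → ∀ k → n ∸ lo < k → e k lo ≈ 0#
    step lo lo≤N ih (suc k) n∸lo<1+k = begin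
      e (suc k) lo                              ≈⟨ e-step k lo lo≤N ⟩
      x lo * e k (suc lo) + e (suc k) (suc lo)  ≈⟨ +-cong (*-congˡ (ih k N∸lo<k)) (ih (suc k) (ℕ.m<n⇒m<1+n N∸lo<k)) ⟩
      x lo * 0# + 0#                            ≈⟨ trans (+-identityʳ _) (zeroʳ _) ⟩
      0#                                        ∎
      where
      N∸lo<k : N ∸ lo < k
      N∸lo<k = ℕ.≤-pred (≡.subst (_< suc k) (ℕ.+-∸-assoc 1 lo≤N) n∸lo<1+k)

  generating-product : Carrier → ℕ → Carrier
  generating-product t lo = Π (n ∸ lo) (λ i → 1# + t * x (lo ℕ.+ i))

  generating-product-step : ∀ t lo → lo ≤ N → generating-product t lo ≈ (1# + t * x lo) * generating-product t (suc lo)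
  generating-product-step t lo lo≤N = begin
    Π (n ∸ lo) (λ i → factor (lo ℕ.+ i))
      ≡⟨ ≡.cong (λ m → Π m (λ i → factor (lo ℕ.+ i))) (ℕ.+-∸-assoc 1 lo≤N) ⟩
    factor (lo ℕ.+ 0) * Π (N ∸ lo) (λ i → factor (lo ℕ.+ suc i))
      ≈⟨ *-cong (reflexive (≡.cong factor (ℕ.+-identityʳ lo))) (Π-cong (N ∸ lo) (λ i → reflexive (≡.cong factor (ℕ.+-suc lo i)))) ⟩
    factor lo * generating-product t (suc lo) ∎
    where
    factor : ℕ → Carrier
    factor i = 1# + t * x i

  e-generating : ∀ t lo M → n ∸ lo < M → Σ M (λ k → e k lo * pow t k) ≈ generating-product t lo
  e-generating t = downward-induction N (λ lo → ∀ M → n ∸ lo < M → Σ M (λ k → e k lo * pow t k) ≈ generating-product t lo) above step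
    where
    above : ∀ lo → N < lo → ∀ M → n ∸ lo < M → Σ M (λ k → e k lo * pow t k) ≈ generating-product t lo
    above lo N<lo (suc M) _ = begin
      1# * 1# + Σ M (λ k → e (suc k) lo * pow t (suc k))
        ≈⟨ +-cong (*-identityʳ _) (Σ-zero M _ (λ k _ → trans (*-congʳ (Z-beyond lo 1 (ones k) N<lo)) (zeroˡ _))) ⟩
      1# + 0#                    ≈⟨ +-identityʳ _ ⟩
      1#                         ≡⟨ ≡.cong (λ m → Π m (λ i → 1# + t * x (lo ℕ.+ i))) (ℕ.m≤n⇒m∸n≡0 N<lo) ⟨
      generating-product t lo    ∎
    step : ∀ lo → lo ≤ N → (∀ M → n ∸ suc lo < M → Σ M (λ k → e k (suc lo) * pow t k) ≈ generating-product t (suc lo))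
           → ∀ M → n ∸ lo < M → Σ M (λ k → e k lo * pow t k) ≈ generating-product t lo
    step lo lo≤N ih (suc M) n∸lo<1+M = begin
      1# * 1# + Σ M (λ k → e (suc k) lo * pow t (suc k))
        ≈⟨ +-congˡ (Σ-cong M (λ k → *-congʳ (e-step k lo lo≤N))) ⟩
      1# * 1# + Σ M (λ k → (x lo * e k (suc lo) + e (suc k) (suc lo)) * pow t (suc k))
        ≈⟨ +-congˡ (Σ-cong M (λ k → solve 5 (λ a b c d p → (a :* b :+ c) :* (d :* p) := (d :* a) :* (b :* p) :+ c :* (d :* p)) refl (x lo) _ _ t _)) ⟩
      1# * 1# + Σ M (λ k → (t * x lo) * (e k (suc lo) * pow t k) + e (suc k) (suc lo) * pow t (suc k))
        ≈⟨ +-congˡ (Σ-distrib-+ M _ _) ⟩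
      1# * 1# + (Σ M (λ k → (t * x lo) * (e k (suc lo) * pow t k)) + Σ M (λ k → e (suc k) (suc lo) * pow t (suc k)))
        ≈⟨ +-congˡ (+-congʳ (*-distribˡ-Σ M (t * x lo) _)) ⟨
      1# * 1# + ((t * x lo) * Σ M (λ k → e k (suc lo) * pow t k) + Σ M (λ k → e (suc k) (suc lo) * pow t (suc k)))
        ≈⟨ solve 3 (λ a b c → con (+ 1) :* con (+ 1) :+ (a :* b :+ c) := a :* b :+ (con (+ 1) :* con (+ 1) :+ c)) refl (t * x lo) _ _ ⟩
      (t * x lo) * Σ M (λ k → e k (suc lo) * pow t k) + Σ (suc M) (λ k → e k (suc lo) * pow t k)
        ≈⟨ +-cong (*-congˡ (ih M N∸lo<M)) (ih (suc M) (ℕ.m<n⇒m<1+n N∸lo<M)) ⟩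
      (t * x lo) * generating-product t (suc lo) + generating-product t (suc lo)
        ≈⟨ solve 2 (λ a p → a :* p :+ p := (con (+ 1) :+ a) :* p) refl (t * x lo) _ ⟩
      (1# + t * x lo) * generating-product t (suc lo)
        ≈⟨ generating-product-step t lo lo≤N ⟨
      generating-product t lo ∎
      where
      N∸lo<M : N ∸ lo < M
      N∸lo<M = ℕ.≤-pred (≡.subst (_< suc M) (ℕ.+-∸-assoc 1 lo≤N) n∸lo<1+M)

  n*t*Σê≈[1+t]^n-1 : ∀ t → (natR n * t) * Σ n (λ k → ê k * pow t k) ≈ pow (1# + t) n - 1#
  n*t*Σê≈[1+t]^n-1 t = begin
    (natR n * t) * Σ n (λ k → ê k * pow t k)                   ≈⟨ *-distribˡ-Σ n (natR n * t) (λ k → ê k * pow t k) ⟩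
    Σ n (λ k → (natR n * t) * (ê k * pow t k))                 ≈⟨ Σ-cong n (λ k → rearrange k) ⟩
    Σ n (λ k → natR (n C suc k) * pow t (suc k))               ≈⟨ solve 1 (λ s → s := (con (+ 1) :+ s) :- con (+ 1)) refl _ ⟩
    (1# + Σ n (λ k → natR (n C suc k) * pow t (suc k))) - 1#   ≈⟨ +-congʳ (+-congʳ (trans (*-identityʳ _) (+-identityʳ 1#))) ⟨
    Σ (suc n) (λ k → natR (n C k) * pow t k) - 1#              ≈⟨ +-congʳ (binomial-theorem t n) ⟨
    pow (1# + t) n - 1#                                        ∎
    where
    rearrange : ∀ k → (natR n * t) * (ê k * pow t k) ≈ natR (n C suc k) * pow t (suc k)
    rearrange k = begin
      (natR n * t) * (ê k * pow t k)   ≈⟨ solve 4 (λ m t e p → (m :* t) :* (e :* p) := (m :* e) :* (t :* p)) refl (natR n) t (ê k) (pow t k) ⟩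
      (natR n * ê k) * (t * pow t k)   ≈⟨ *-congʳ (n*ê k) ⟩
      natR (n C suc k) * pow t (suc k) ∎

  node : ℕ → Carrier
  node i = pow ζ (suc i) - 1#

  node≉0 : ∀ i → i < N → ¬ (node i ≈ 0#)
  node≉0 i i<N node≈0 = ζ^k≉1 (suc i) (s≤s z≤n) (s≤s i<N) (begin
    pow ζ (suc i)   ≈⟨ solve 1 (λ a → a := (a :- con (+ 1)) :+ con (+ 1)) refl _ ⟩
    node i + 1#     ≈⟨ +-congʳ node≈0 ⟩
    0# + 1#         ≈⟨ +-identityˡ _ ⟩
    1#              ∎)

  node-injective : ∀ i j → i < j → j < N → ¬ (node i ≈ node j)
  node-injective i j i<j j<N nodeᵢ≈nodeⱼ = ζ^-injective (suc i) (suc j) (s≤s i<j) (s≤s j<N) (begin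
    pow ζ (suc j)   ≈⟨ solve 1 (λ a → a := (a :- con (+ 1)) :+ con (+ 1)) refl _ ⟩
    node j + 1#     ≈⟨ +-congʳ nodeᵢ≈nodeⱼ ⟨
    node i + 1#     ≈⟨ solve 1 (λ a → (a :- con (+ 1)) :+ con (+ 1) := a) refl _ ⟩
    pow ζ (suc i)   ∎)

  -- Σ_k e k 1 t^k = Π_{1 ≤ i ≤ N} (1 + t x i) and Σ_k ê k t^k = ((1 + t)^n - 1) / (n t) are
  -- polynomials of degree < n that equal 1 at 0 and vanish at the N nodes ζ^i - 1.
  difference : List Carrier
  difference = applyUpTo (λ k → e k 1 - ê k) n

  evalP-difference : ∀ t → evalP difference t ≈ generating-product t 1 - Σ n (λ k → ê k * pow t k)
  evalP-difference t = begin
    evalP difference t                                                 ≈⟨ evalP-applyUpTo n (λ k → e k 1 - ê k) t ⟩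
    Σ n (λ k → (e k 1 - ê k) * pow t k)
      ≈⟨ Σ-cong n (λ k → solve 3 (λ a b p → (a :- b) :* p := a :* p :- b :* p) refl (e k 1) (ê k) (pow t k)) ⟩
    Σ n (λ k → e k 1 * pow t k - ê k * pow t k)                        ≈⟨ Σ-distrib-− n (λ k → e k 1 * pow t k) (λ k → ê k * pow t k) ⟩
    Σ n (λ k → e k 1 * pow t k) - Σ n (λ k → ê k * pow t k)            ≈⟨ +-congʳ (e-generating t 1 n (ℕ.n<1+n N)) ⟩
    generating-product t 1 - Σ n (λ k → ê k * pow t k)                 ∎

  difference-at-node : ∀ i → i < N → evalP difference (node i) ≈ 0#
  difference-at-node i i<N = begin
    evalP difference (node i)                                         ≈⟨ evalP-difference (node i) ⟩
    generating-product (node i) 1 - Σ n (λ k → ê k * pow (node i) k) ≈⟨ +-cong product≈0 (-‿cong Σ≈0) ⟩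
    0# - 0#                                                           ≈⟨ -‿inverseʳ 0# ⟩
    0#                                                                ∎
    where
    product≈0 : generating-product (node i) 1 ≈ 0#
    product≈0 = Π-zero N _ i i<N (begin
      1# + node i * x (suc i)                 ≈⟨ solve 2 (λ a y → con (+ 1) :+ (a :- con (+ 1)) :* y := con (+ 1) :- (con (+ 1) :- a) :* y) refl (pow ζ (suc i)) _ ⟩
      1# - (1# - pow ζ (suc i)) * x (suc i)   ≈⟨ +-congˡ (-‿cong ([1-ζ^i]*x≈1 (suc i) (s≤s z≤n) (s≤s i<N))) ⟩
      1# - 1#                                 ≈⟨ -‿inverseʳ 1# ⟩
      0#                                      ∎)
    [1+node]^n≈1 : pow (1# + node i) n ≈ 1#
    [1+node]^n≈1 = begin
      pow (1# + node i) n         ≈⟨ pow-cong n (solve 1 (λ a → con (+ 1) :+ (a :- con (+ 1)) := a) refl _) ⟩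
      pow (pow ζ (suc i)) n       ≈⟨ pow-pow ζ (suc i) n ⟩
      pow ζ (suc i ℕ.* n)         ≡⟨ ≡.cong (pow ζ) (ℕ.*-comm (suc i) n) ⟩
      pow ζ (n ℕ.* suc i)         ≈⟨ pow-pow ζ n (suc i) ⟨
      pow (pow ζ n) (suc i)       ≈⟨ pow-cong (suc i) ζ^n≈1 ⟩
      pow 1# (suc i)              ≈⟨ pow-1# (suc i) ⟩
      1#                          ∎
    Σ≈0 : Σ n (λ k → ê k * pow (node i) k) ≈ 0#
    Σ≈0 = x*y≈0⇒y≈0 (*-≉0 n≉0 (node≉0 i i<N))
      (trans (n*t*Σê≈[1+t]^n-1 (node i)) (trans (+-congʳ [1+node]^n≈1) (-‿inverseʳ 1#)))

  difference-at-zero : evalP difference 0# ≈ 0#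
  difference-at-zero = begin
    (e 0 1 - ê 0) + 0# * evalP (applyUpTo (λ k → e (suc k) 1 - ê (suc k)) N) 0#
                      ≈⟨ +-congˡ (zeroˡ _) ⟩
    (1# - ê 0) + 0#   ≈⟨ +-identityʳ _ ⟩
    1# - ê 0          ≈⟨ +-congˡ (-‿cong ê-zero) ⟩
    1# - 1#           ≈⟨ -‿inverseʳ 1# ⟩
    0#                ∎

  elementary-symmetric : ∀ k → e k 1 ≈ ê k
  elementary-symmetric k with k ℕ.<? n
  ... | yes k<n = begin
    e k 1                    ≈⟨ solve 2 (λ a b → a := (a :- b) :+ b) refl _ _ ⟩
    (e k 1 - ê k) + ê k      ≈⟨ +-congʳ (All.applyUpTo⁻ (λ k → e k 1 - ê k) n difference≈0 k<n) ⟩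
    0# + ê k                 ≈⟨ +-identityˡ _ ⟩
    ê k                      ∎
    where
    difference≈0 : All (_≈ 0#) difference
    difference≈0 = vanishing-at-distinct-points (0# ∷ applyUpTo node N) difference
      (≡.trans (≡.cong suc (List.length-applyUpTo node N)) (≡.sym (List.length-applyUpTo (λ k → e k 1 - ê k) n)))
      (All.applyUpTo⁺₁ node N (λ i<N → node≉0 _ i<N ∘ sym) ∷ AllPairs.applyUpTo⁺₁ node N (λ {i} {j} → node-injective i j))
      (difference-at-zero ∷ All.applyUpTo⁺₁ node N (difference-at-node _))
  ... | no k≮n = begin
    e k 1       ≈⟨ e-vanishes 1 k (ℕ.<-≤-trans (ℕ.n<1+n N) (ℕ.≮⇒≥ k≮n)) ⟩
    0#          ≈⟨ zeroˡ _ ⟨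
    natR 0 * natR n ⁻¹        ≡⟨ ≡.cong (λ c → natR c * natR n ⁻¹) (k>n⇒nCk≡0 (s≤s (ℕ.≮⇒≥ k≮n))) ⟨
    ê k         ∎

module NewtonIdentities {c ℓ} (K : Char0Field c ℓ) (N : ℕ) (ζ : Char0Field.Carrier K)
                        (ζ-primitive : Char0Field.IsPrimitiveRoot K (suc N) ζ) where
  open Char0Field K
  open RingArithmetic cring
  open FiniteSums cring
  open RootsOfUnity K N ζ ζ-primitive
  open RingSolver using (solve; _:+_; _:*_; _:-_; _:=_)
  open import Algebra.Properties.Ring ring using (-0#≈0#)
  open import Relation.Binary.Reasoning.Setoid setoid

  p : ℕ → ℕ → Carrier
  p r lo = Z lo (r ∷ [])

  p-step : ∀ r lo → lo ≤ N → p r lo ≈ pow (x lo) r + p r (suc lo)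
  p-step r lo lo≤N = trans (Z-step lo r [] lo≤N) (+-congʳ (*-identityʳ _))

  exponents : ℕ → ℕ → ℕ → List ℕ
  exponents m A j = applyUpTo (λ i → if i ≡ᵇ j then A else 1) m

  exponents-1 : ∀ m j → exponents m 1 j ≡ ones m
  exponents-1 zero    j       = ≡.refl
  exponents-1 (suc m) zero    = ≡.refl
  exponents-1 (suc m) (suc j) = ≡.cong (1 ∷_) (exponents-1 m j)

  spread-sum : ℕ → ℕ → ℕ → Carrier
  spread-sum A m lo = Σ m (λ j → Z lo (exponents m A j))

  -- newton-sum A (suc m) lo = Σ_{k ≤ m} (-1)^k p (A + k) lo * e (m - k) lo
  newton-sum : ℕ → ℕ → ℕ → Carrier
  newton-sum A zero    lo = 0#
  newton-sum A (suc m) lo = p A lo * e m lo - newton-sum (suc A) m lo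

  spread-sum-step : ∀ A m lo → lo ≤ N →
    spread-sum A (suc m) lo ≈ pow (x lo) A * e m (suc lo) + x lo * spread-sum A m (suc lo) + spread-sum A (suc m) (suc lo)
  spread-sum-step A m lo lo≤N = begin
    Z lo (A ∷ ones m) + Σ m (λ j → Z lo (1 ∷ exponents m A j))
      ≈⟨ +-cong (Z-step lo A (ones m) lo≤N)
                (Σ-cong m {g = λ j → x lo * Z (suc lo) (exponents m A j) + Z (suc lo) (1 ∷ exponents m A j)}
                         (λ j → trans (Z-step lo 1 (exponents m A j) lo≤N) (+-congʳ (*-congʳ (*-identityʳ _))))) ⟩
    (a + b) + Σ m (λ j → x lo * Z (suc lo) (exponents m A j) + Z (suc lo) (1 ∷ exponents m A j))
      ≈⟨ +-congˡ (Σ-distrib-+ m (λ j → x lo * Z (suc lo) (exponents m A j)) (λ j → Z (suc lo) (1 ∷ exponents m A j))) ⟩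
    (a + b) + (Σ m (λ j → x lo * Z (suc lo) (exponents m A j)) + d)
      ≈⟨ +-congˡ (+-congʳ (*-distribˡ-Σ m (x lo) (λ j → Z (suc lo) (exponents m A j)))) ⟨
    (a + b) + (x lo * spread-sum A m (suc lo) + d)
      ≈⟨ solve 4 (λ a b c d → (a :+ b) :+ (c :+ d) := a :+ c :+ (b :+ d)) refl a b _ d ⟩
    a + x lo * spread-sum A m (suc lo) + (b + d) ∎
    where
    a b d : Carrier
    a = pow (x lo) A * e m (suc lo)
    b = Z (suc lo) (A ∷ ones m)
    d = Σ m (λ j → Z (suc lo) (1 ∷ exponents m A j))

  newton-sum-step : ∀ lo → lo ≤ N → ∀ A m →
    newton-sum A (suc m) lo ≈ pow (x lo) A * e m (suc lo) + x lo * newton-sum A m (suc lo) + newton-sum A (suc m) (suc lo)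
  newton-sum-step lo lo≤N A zero = begin
    p A lo * 1# - 0#                                    ≈⟨ +-congʳ (*-congʳ (p-step A lo lo≤N)) ⟩
    (pow (x lo) A + p A (suc lo)) * 1# - 0#
      ≈⟨ solve 3 (λ a y q → (a :+ q) :* con (+ 1) :- con (+ 0) := a :* con (+ 1) :+ y :* con (+ 0) :+ (q :* con (+ 1) :- con (+ 0))) refl (pow (x lo) A) (x lo) (p A (suc lo)) ⟩
    pow (x lo) A * 1# + x lo * 0# + (p A (suc lo) * 1# - 0#) ∎
    where
    open RingSolver using (con)
    open import Data.Integer using (+_)
  newton-sum-step lo lo≤N A (suc m) = begin
    p A lo * e (suc m) lo - newton-sum (suc A) (suc m) lo
      ≈⟨ +-cong (*-cong (p-step A lo lo≤N) (e-step m lo lo≤N)) (-‿cong (newton-sum-step lo lo≤N (suc A) m)) ⟩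
    (xᴬ + pᴬ) * (y * eₘ + eₘ₊₁) - (y * xᴬ * eₘ + y * S + S′)
      ≈⟨ solve 7 (λ xᴬ y pᴬ eₘ eₘ₊₁ S S′ → (xᴬ :+ pᴬ) :* (y :* eₘ :+ eₘ₊₁) :- (y :* xᴬ :* eₘ :+ y :* S :+ S′)
                   := xᴬ :* eₘ₊₁ :+ y :* (pᴬ :* eₘ :- S) :+ (pᴬ :* eₘ₊₁ :- S′)) refl xᴬ y pᴬ eₘ eₘ₊₁ S S′ ⟩
    xᴬ * eₘ₊₁ + y * (pᴬ * eₘ - S) + (pᴬ * eₘ₊₁ - S′) ∎
    where
    xᴬ y pᴬ eₘ eₘ₊₁ S S′ : Carrier
    xᴬ = pow (x lo) A
    y = x lo
    pᴬ = p A (suc lo)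
    eₘ = e m (suc lo)
    eₘ₊₁ = e (suc m) (suc lo)
    S = newton-sum (suc A) m (suc lo)
    S′ = newton-sum (suc A) (suc m) (suc lo)

  spread-sum≈newton-sum : ∀ lo A m → spread-sum A m lo ≈ newton-sum A m lo
  spread-sum≈newton-sum = downward-induction N (λ lo → ∀ A m → spread-sum A m lo ≈ newton-sum A m lo) above step
    where
    spread-sum-beyond : ∀ lo → N < lo → ∀ A m → spread-sum A m lo ≈ 0#
    spread-sum-beyond lo N<lo A zero    = refl
    spread-sum-beyond lo N<lo A (suc m) =
      Σ-zero (suc m) (λ j → Z lo (exponents (suc m) A j))
        (λ j _ → Z-beyond lo (if 0 ≡ᵇ j then A else 1) (applyUpTo (λ i → if suc i ≡ᵇ j then A else 1) m) N<lo)
    newton-sum-beyond : ∀ lo → N < lo → ∀ A m → newton-sum A m lo ≈ 0#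
    newton-sum-beyond lo N<lo A zero    = refl
    newton-sum-beyond lo N<lo A (suc m) =
      trans (+-cong (trans (*-congʳ (Z-beyond lo A [] N<lo)) (zeroˡ _)) (-‿cong (newton-sum-beyond lo N<lo (suc A) m)))
            (trans (+-congˡ -0#≈0#) (+-identityʳ _))
    above : ∀ lo → N < lo → ∀ A m → spread-sum A m lo ≈ newton-sum A m lo
    above lo N<lo A m = trans (spread-sum-beyond lo N<lo A m) (sym (newton-sum-beyond lo N<lo A m))
    step : ∀ lo → lo ≤ N → (∀ A m → spread-sum A m (suc lo) ≈ newton-sum A m (suc lo)) →
           ∀ A m → spread-sum A m lo ≈ newton-sum A m lo
    step lo lo≤N ih A zero    = refl
    step lo lo≤N ih A (suc m) =
      trans (spread-sum-step A m lo lo≤N)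
            (trans (+-cong (+-congˡ (*-congˡ (ih A m))) (ih A (suc m))) (sym (newton-sum-step lo lo≤N A m)))

  newton-identity : ∀ m → natR m * e m 1 ≈ newton-sum 1 m 1
  newton-identity m = begin
    natR m * e m 1                     ≈⟨ Σ-const m (e m 1) ⟨
    Σ m (λ _ → e m 1)                  ≈⟨ Σ-cong m (λ j → reflexive (≡.cong (Z 1) (exponents-1 m j))) ⟨
    spread-sum 1 m 1                   ≈⟨ spread-sum≈newton-sum 1 1 m ⟩
    newton-sum 1 m 1                   ∎

-- Power sums and degenerate Bernoulli numbers

module BinomialQuotientSeries {c ℓ} (K : Char0Field c ℓ) (N : ℕ) where
  open Char0Field K
  open RingArithmetic cring
  open FieldArithmetic K
  open PowerSeries cring
  open SeriesSubstitution cring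
  open BinomialQuotient K N
  open import Data.Integer using (+_)
  open import Algebra.Properties.Ring ring using (-0#≈0#)
  module ≋ = CommutativeRing series-ring
  module Series = RingArithmetic series-ring
  module ≋-Reasoning = Relation.Binary.Reasoning.Setoid ≋.setoid

  nX : Series
  nX = natRₛ n ⋆ X

  nX⋆-zero : ∀ f → (nX ⋆ f) 0 ≈ 0#
  nX⋆-zero f = trans (⋆-assoc (natRₛ n) X f 0) (trans (natRₛ⋆ n (X ⋆ f) 0) (trans (*-congˡ (X⋆-zero f)) (zeroʳ _)))

  nX⋆-suc : ∀ f k → (nX ⋆ f) (suc k) ≈ natR n * f k
  nX⋆-suc f k = trans (⋆-assoc (natRₛ n) X f (suc k)) (trans (natRₛ⋆ n (X ⋆ f) (suc k)) (*-congˡ (X⋆-suc f k)))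

  nX⋆-cancel : ∀ {f g} → nX ⋆ f ≋ nX ⋆ g → f ≋ g
  nX⋆-cancel {f} {g} nXf≋nXg k = *-cancelˡ n≉0 (trans (sym (nX⋆-suc f k)) (trans (nXf≋nXg (suc k)) (nX⋆-suc g k)))

  nX⋆ê : nX ⋆ ê ≋ powₛ (δ ⊕ X) n ⊝ δ
  nX⋆ê zero    = trans (nX⋆-zero ê) (sym (trans (+-congʳ (trans (binomial-series n 0) (+-identityʳ 1#))) (-‿inverseʳ 1#)))
  nX⋆ê (suc j) = trans (nX⋆-suc ê j) (trans (n*ê j) (sym (trans (+-cong (binomial-series n (suc j)) -0#≈0#) (+-identityʳ _))))

  nX⋆ê[-X] : nX ⋆ alternate ê ≋ δ ⊝ powₛ (δ ⊝ X) n
  nX⋆ê[-X] zero    = trans (nX⋆-zero (alternate ê))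
    (sym (trans (+-congˡ (-‿cong (trans (alternating-binomial-series n 0) (trans (*-identityˡ _) (+-identityʳ 1#))))) (-‿inverseʳ 1#)))
  nX⋆ê[-X] (suc j) = begin
    (nX ⋆ alternate ê) (suc j)                  ≈⟨ nX⋆-suc (alternate ê) j ⟩
    natR n * (sgn j * ê j)                       ≈⟨ solve 3 (λ m s e → m :* (s :* e) := s :* (m :* e)) refl _ _ _ ⟩
    sgn j * (natR n * ê j)                       ≈⟨ *-congˡ (n*ê j) ⟩
    sgn j * natR (n C suc j)                     ≈⟨ solve 2 (λ s c → s :* c := con (+ 0) :- (:- s) :* c) refl _ _ ⟩
    0# - (- sgn j) * natR (n C suc j)            ≈⟨ +-congˡ (-‿cong (*-congʳ (sgn-suc j))) ⟨
    0# - sgn (suc j) * natR (n C suc j)          ≈⟨ +-congˡ (-‿cong (alternating-binomial-series n (suc j))) ⟨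
    (δ ⊝ powₛ (δ ⊝ X) n) (suc j)                ∎
    where
    open import Relation.Binary.Reasoning.Setoid setoid
    open RingSolver using (solve; _:*_; :-_; _:-_; _:=_; con)

  substitute-nX⋆ê : (natRₛ n ⋆ X/[1-X]) ⋆ substitute ê ≋ powₛ (δ ⊕ X/[1-X]) n ⊝ δ
  substitute-nX⋆ê = begin
    (natRₛ n ⋆ X/[1-X]) ⋆ substitute ê
      ≈⟨ ≋.*-cong (≋.*-cong (substitute-natRₛ n) substitute-X) ≋.refl ⟨
    (substitute (natRₛ n) ⋆ substitute X) ⋆ substitute ê
      ≈⟨ ≋.*-cong (substitute-⋆ (natRₛ n) X) ≋.refl ⟨
    substitute nX ⋆ substitute ê      ≈⟨ substitute-⋆ nX ê ⟨
    substitute (nX ⋆ ê)               ≈⟨ substitute-cong nX⋆ê ⟩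
    substitute (powₛ (δ ⊕ X) n ⊝ δ)   ≈⟨ ≋.trans (substitute-⊕ (powₛ (δ ⊕ X) n) (⊝ δ)) (≋.+-cong ≋.refl (substitute-⊝ δ)) ⟩
    substitute (powₛ (δ ⊕ X) n) ⊝ substitute δ
      ≈⟨ ≋.+-cong (≋.trans (substitute-powₛ (δ ⊕ X) n) (Series.pow-cong n (substitute-⊕ δ X)))
                  (≋.-‿cong substitute-δ) ⟩
    powₛ (substitute δ ⊕ substitute X) n ⊝ δ
      ≈⟨ ≋.+-cong (Series.pow-cong n (≋.+-cong substitute-δ substitute-X)) ≋.refl ⟩
    powₛ (δ ⊕ X/[1-X]) n ⊝ δ          ∎
    where open ≋-Reasoning

  -- ê(-X) = ê(X / (1 - X)) (1 - X)^N, checked after multiplying both sides by n X.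
  ê[-X]≋substitute-ê⋆[1-X]^N : alternate ê ≋ substitute ê ⋆ powₛ (δ ⊝ X) N
  ê[-X]≋substitute-ê⋆[1-X]^N = ≋.sym (nX⋆-cancel (begin
    nX ⋆ (substitute ê ⋆ powₛ r N)
      ≈⟨ ≋.*-cong (≋.*-cong ≋.refl (≋.sym X/[1-X]⋆[1-X])) ≋.refl ⟩
    (natRₛ n ⋆ (X/[1-X] ⋆ r)) ⋆ (substitute ê ⋆ powₛ r N)
      ≈⟨ solve 5 (λ m u e r R → (m :* (u :* r)) :* (e :* R) := ((m :* u) :* e) :* (r :* R)) ≋.refl (natRₛ n) X/[1-X] (substitute ê) r (powₛ r N) ⟩
    ((natRₛ n ⋆ X/[1-X]) ⋆ substitute ê) ⋆ powₛ r n
      ≈⟨ ≋.*-cong substitute-nX⋆ê ≋.refl ⟩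
    (powₛ (δ ⊕ X/[1-X]) n ⊝ δ) ⋆ powₛ r n
      ≈⟨ solve 2 (λ a b → (a :- con (+ 1)) :* b := a :* b :- b) ≋.refl (powₛ (δ ⊕ X/[1-X]) n) (powₛ r n) ⟩
    powₛ (δ ⊕ X/[1-X]) n ⋆ powₛ r n ⊝ powₛ r n
      ≈⟨ ≋.+-cong (Series.pow-distrib-* (δ ⊕ X/[1-X]) r n) ≋.refl ⟨
    powₛ ((δ ⊕ X/[1-X]) ⋆ r) n ⊝ powₛ r n
      ≈⟨ ≋.+-cong (≋.trans (Series.pow-cong n [1+X/[1-X]]⋆[1-X]≋δ) (Series.pow-1# n)) ≋.refl ⟩
    δ ⊝ powₛ r n                      ≈⟨ nX⋆ê[-X] ⟨
    nX ⋆ alternate ê                  ∎))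
    where
    open ≋-Reasoning
    open Series.RingSolver using (solve; _:*_; _:-_; _:=_; con)
    r : Series
    r = δ ⊝ X
    [1+X/[1-X]]⋆[1-X]≋δ : (δ ⊕ X/[1-X]) ⋆ r ≋ δ
    [1+X/[1-X]]⋆[1-X]≋δ k = trans (⋆-distribʳ-⊕ r δ X/[1-X] k)
      (trans (+-cong (⋆-identityˡ r k) (X/[1-X]⋆[1-X] k)) (trans (+-assoc _ _ _) (trans (+-congˡ (-‿inverseˡ _)) (+-identityʳ _))))

  substitute-inverse⋆ê[-X] : ∀ b → b ⋆ ê ≋ δ → substitute b ⋆ alternate ê ≋ powₛ (δ ⊝ X) N
  substitute-inverse⋆ê[-X] b b⋆ê≋δ = begin
    substitute b ⋆ alternate ê
      ≈⟨ ≋.*-cong ≋.refl ê[-X]≋substitute-ê⋆[1-X]^N ⟩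
    substitute b ⋆ (substitute ê ⋆ powₛ (δ ⊝ X) N)
      ≈⟨ ≋.*-assoc _ _ _ ⟨
    (substitute b ⋆ substitute ê) ⋆ powₛ (δ ⊝ X) N
      ≈⟨ ≋.*-cong (≋.trans (≋.sym (substitute-⋆ b ê)) (≋.trans (substitute-cong b⋆ê≋δ) substitute-δ)) ≋.refl ⟩
    δ ⋆ powₛ (δ ⊝ X) N
      ≈⟨ ⋆-identityˡ _ ⟩
    powₛ (δ ⊝ X) N ∎
    where open ≋-Reasoning

module DegenerateBernoulliRecursion where
  open import Data.Product using (_×_)

  βlist≡applyUpTo : ∀ lam k → βlist lam k ≡ applyUpTo (β lam) k
  βlist≡applyUpTo lam zero    = ≡.refl
  βlist≡applyUpTo lam (suc k) = ≡.trans (≡.cong (_++ [ β lam k ]) (βlist≡applyUpTo lam k)) (List.applyUpTo-∷ʳ (β lam) k)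

  zip-applyUpTo : ∀ {A B : Set} k (f : ℕ → A) (g : ℕ → B) → zip (applyUpTo f k) (applyUpTo g k) ≡ applyUpTo (λ i → (f i , g i)) k
  zip-applyUpTo zero    f g = ≡.refl
  zip-applyUpTo (suc k) f g = ≡.cong (_ ∷_) (zip-applyUpTo k (f ∘ suc) (g ∘ suc))

  δℚ : ℕ → ℚ
  δℚ k = if k ≡ᵇ 0 then ℚ.1ℚ else ℚ.0ℚ

  β-summand : ℚ → ℕ → ℕ → ℚ
  β-summand lam k i = ℕtoℚ (suc k C i) ℚ.* β lam i ℚ.* degFall lam (suc k ∸ i)

  β-recursion : ∀ lam k → β lam k ≡ (δℚ k ℚ.- sumℚ (applyUpTo (β-summand lam k) k)) ÷ℕ suc k
  β-recursion lam k =
    ≡.trans (≡.cong₂ step length≡k zip≡) (≡.cong (λ l → (δℚ k ℚ.- sumℚ l) ÷ℕ suc k) (List.map-applyUpTo (λ i → (i , β lam i)) _ k))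
    where
    step : ℕ → List (ℕ × ℚ) → ℚ
    step L zs = (δℚ L ℚ.- sumℚ (map (λ kb → ℕtoℚ (suc L C proj₁ kb) ℚ.* proj₂ kb ℚ.* degFall lam (suc L ∸ proj₁ kb)) zs)) ÷ℕ suc L
    length≡k : length (βlist lam k) ≡ k
    length≡k = ≡.trans (≡.cong length (βlist≡applyUpTo lam k)) (List.length-applyUpTo (β lam) k)
    zip≡ : zip (upTo (length (βlist lam k))) (βlist lam k) ≡ applyUpTo (λ i → (i , β lam i)) k
    zip≡ = ≡.trans (≡.cong₂ (λ L l → zip (upTo L) l) length≡k (βlist≡applyUpTo lam k)) (zip-applyUpTo k id (β lam))

module DegenerateBernoulliSeries {c ℓ} (K : Char0Field c ℓ) (N : ℕ) where
  open Char0Field K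
  open RingArithmetic cring
  open FiniteSums cring
  open FieldArithmetic K
  open RationalEmbedding K
  open PowerSeries cring
  open BinomialQuotient K N
  open DegenerateBernoulliRecursion
  open RingSolver using (solve; _:+_; _:*_; _:-_; _:=_; con)
  open import Relation.Binary.Reasoning.Setoid setoid

  1/n : ℚ
  1/n = + 1 ℚ./ n

  ι-1/n : ι 1/n ≈ natR n ⁻¹
  ι-1/n = trans (ι-/ (+ 1) N) (trans (*-congʳ (+-identityʳ 1#)) (*-identityˡ _))

  B : ℕ → Carrier
  B i = ι (β 1/n i)

  φ : ℕ → Carrier
  φ j = ι (degFall 1/n j)

  k!≉0 : ∀ k → ¬ (natR (k !) ≈ 0#)
  k!≉0 k = natR≉0# (ℕ.≢-nonZero⁻¹ (k !) {{ℕ._!≢0 k}})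

  φ*n^j≈j!*nCj : ∀ j → φ j * pow (natR n) j ≈ natR (j !) * natR (n C j)
  φ*n^j≈j!*nCj zero    = trans (*-congʳ ι-1) (trans (*-identityˡ 1#) (sym (trans (*-cong (+-identityʳ 1#) (+-identityʳ 1#)) (*-identityˡ _))))
  φ*n^j≈j!*nCj (suc j) = begin
    φ (suc j) * (natR n * pow (natR n) j)
      ≈⟨ *-congʳ (trans (ι-homo-* (degFall 1/n j) (ℚ.1ℚ ℚ.- ℕtoℚ j ℚ.* 1/n)) (*-congˡ ι-1-j/n)) ⟩
    (φ j * (1# - natR j * natR n ⁻¹)) * (natR n * pow (natR n) j)
      ≈⟨ solve 5 (λ f J ni m P → (f :* (con (+ 1) :- J :* ni)) :* (m :* P) := (f :* P) :* (m :- J :* (m :* ni))) refl (φ j) (natR j) (natR n ⁻¹) (natR n) (pow (natR n) j) ⟩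
    (φ j * pow (natR n) j) * (natR n - natR j * (natR n * natR n ⁻¹))
      ≈⟨ *-cong (φ*n^j≈j!*nCj j) (+-congˡ (-‿cong (trans (*-congˡ (⁻¹-inverse _ n≉0)) (*-identityʳ _)))) ⟩
    (natR (j !) * natR (n C j)) * (natR n - natR j)
      ≈⟨ solve 4 (λ F c m J → (F :* c) :* (m :- J) := F :* (m :* c :- J :* c)) refl (natR (j !)) (natR (n C j)) (natR n) (natR j) ⟩
    natR (j !) * (natR n * natR (n C j) - natR j * natR (n C j))
      ≈⟨ *-congˡ absorption ⟩
    natR (j !) * (natR (suc j) * natR (n C suc j))
      ≈⟨ solve 3 (λ F s c → F :* (s :* c) := (s :* F) :* c) refl (natR (j !)) (natR (suc j)) (natR (n C suc j)) ⟩
    (natR (suc j) * natR (j !)) * natR (n C suc j)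
      ≈⟨ *-congʳ (natR-homo-* (suc j) (j !)) ⟨
    natR (suc j !) * natR (n C suc j) ∎
    where
    ι-1-j/n : ι (ℚ.1ℚ ℚ.- ℕtoℚ j ℚ.* 1/n) ≈ 1# - natR j * natR n ⁻¹
    ι-1-j/n = trans (ι-homo-− ℚ.1ℚ (ℕtoℚ j ℚ.* 1/n)) (+-cong ι-1 (-‿cong (trans (ι-homo-* (ℕtoℚ j) 1/n) (*-cong (ι-ℕtoℚ j) ι-1/n))))
    absorption : natR n * natR (n C j) - natR j * natR (n C j) ≈ natR (suc j) * natR (n C suc j)
    absorption = begin
      natR n * natR (n C j) - natR j * natR (n C j)
        ≈⟨ +-congʳ (natR-homo-* n (n C j)) ⟨
      natR (n ℕ.* (n C j)) - natR j * natR (n C j)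
        ≡⟨ ≡.cong (λ z → natR z - natR j * natR (n C j)) ([1+k]*nC[1+k]+k*nCk≡n*nCk n j) ⟨
      natR (suc j ℕ.* (n C suc j) ℕ.+ j ℕ.* (n C j)) - natR j * natR (n C j)
        ≈⟨ +-congʳ (trans (natR-homo-+ (suc j ℕ.* (n C suc j)) (j ℕ.* (n C j))) (+-cong (natR-homo-* (suc j) (n C suc j)) (natR-homo-* j (n C j)))) ⟩
      (natR (suc j) * natR (n C suc j) + natR j * natR (n C j)) - natR j * natR (n C j)
        ≈⟨ solve 2 (λ a b → (a :+ b) :- b := a) refl _ _ ⟩
      natR (suc j) * natR (n C suc j) ∎

  β-term : ℕ → ℕ → Carrier
  β-term k i = natR (suc k C i) * B i * φ (suc k ∸ i)

  φ-1 : φ 1 ≈ 1#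
  φ-1 = *-cancelˡ n≉0 (begin
    natR n * φ 1                   ≈⟨ *-comm _ _ ⟩
    φ 1 * natR n                   ≈⟨ *-congˡ (*-identityʳ _) ⟨
    φ 1 * pow (natR n) 1           ≈⟨ φ*n^j≈j!*nCj 1 ⟩
    natR 1 * natR (n C 1)          ≈⟨ *-cong (+-identityʳ 1#) (reflexive (≡.cong natR (nC1≡n n))) ⟩
    1# * natR n                    ≈⟨ *-comm _ _ ⟩
    natR n * 1#                    ∎)

  B*[1+k] : ∀ k → B k * natR (suc k) ≈ δ k - Σ k (β-term k)
  B*[1+k] k = begin
    ι (β 1/n k) * natR (suc k)
      ≡⟨ ≡.cong (λ q → ι q * natR (suc k)) (β-recursion 1/n k) ⟩
    ι ((δℚ k ℚ.- sumℚ (applyUpTo (β-summand 1/n k) k)) ÷ℕ suc k) * natR (suc k)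
      ≈⟨ *-congʳ (ι-÷ℕ (δℚ k ℚ.- sumℚ (applyUpTo (β-summand 1/n k) k)) {suc k} (λ ())) ⟩
    (ι (δℚ k ℚ.- sumℚ (applyUpTo (β-summand 1/n k) k)) * natR (suc k) ⁻¹) * natR (suc k)
      ≈⟨ trans (*-assoc _ _ _) (trans (*-congˡ (⁻¹-inverseˡ _ (char0 k))) (*-identityʳ _)) ⟩
    ι (δℚ k ℚ.- sumℚ (applyUpTo (β-summand 1/n k) k))
      ≈⟨ ι-homo-− (δℚ k) (sumℚ (applyUpTo (β-summand 1/n k) k)) ⟩
    ι (δℚ k) - ι (sumℚ (applyUpTo (β-summand 1/n k) k))
      ≈⟨ +-cong (ι-δℚ k) (-‿cong (trans (ι-sumℚ-applyUpTo k (β-summand 1/n k)) (Σ-cong k ι-β-summand))) ⟩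
    δ k - Σ k (β-term k) ∎
    where
    ι-δℚ : ∀ k → ι (δℚ k) ≈ δ k
    ι-δℚ zero    = ι-1
    ι-δℚ (suc k) = ι-0
    ι-β-summand : ∀ i → ι (β-summand 1/n k i) ≈ β-term k i
    ι-β-summand i =
      trans (ι-homo-* (ℕtoℚ (suc k C i) ℚ.* β 1/n i) (degFall 1/n (suc k ∸ i)))
            (*-congʳ (trans (ι-homo-* (ℕtoℚ (suc k C i)) (β 1/n i)) (*-congʳ (ι-ℕtoℚ (suc k C i)))))

  β-recursionᴷ : ∀ k → Σ (suc k) (β-term k) ≈ δ k
  β-recursionᴷ k = begin
    Σ (suc k) (β-term k)                      ≈⟨ Σ-snoc k (β-term k) ⟩
    Σ k (β-term k) + β-term k k               ≈⟨ +-congˡ last-term ⟩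
    Σ k (β-term k) + B k * natR (suc k)       ≈⟨ +-congˡ (B*[1+k] k) ⟩
    Σ k (β-term k) + (δ k - Σ k (β-term k))   ≈⟨ solve 2 (λ a d → a :+ (d :- a) := d) refl _ _ ⟩
    δ k                                       ∎
    where
    last-term : β-term k k ≈ B k * natR (suc k)
    last-term = begin
      natR (suc k C k) * B k * φ (suc k ∸ k)   ≡⟨ ≡.cong₂ (λ c d → natR c * B k * φ d) [1+k]Ck≡1+k (ℕ.m+n∸n≡m 1 k) ⟩
      natR (suc k) * B k * φ 1                 ≈⟨ trans (*-congˡ φ-1) (*-identityʳ _) ⟩
      natR (suc k) * B k                       ≈⟨ *-comm _ _ ⟩
      B k * natR (suc k)                       ∎
      where
      [1+k]Ck≡1+k : suc k C k ≡ suc k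
      [1+k]Ck≡1+k = ≡.trans (nCk≡nC[n∸k] (ℕ.n≤1+n k)) (≡.trans (≡.cong (suc k C_) (ℕ.m+n∸n≡m 1 k)) (nC1≡n (suc k)))

  -- b i = n^i β_i(1/n) / i!, the coefficients of n X / ((1 + X)^n - 1)
  b : ℕ → Carrier
  b i = pow (natR n) i * B i * natR (i !) ⁻¹

  [K∸i]!*KCi*K!⁻¹≈i!⁻¹ : ∀ {K i} → i ≤ K → natR ((K ∸ i) !) * natR (K C i) * natR (K !) ⁻¹ ≈ natR (i !) ⁻¹
  [K∸i]!*KCi*K!⁻¹≈i!⁻¹ {K} {i} i≤K = ⁻¹-unique (k!≉0 i) (begin
    natR (i !) * (natR ((K ∸ i) !) * natR (K C i) * natR (K !) ⁻¹)   ≈⟨ *-assoc _ _ _ ⟨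
    (natR (i !) * (natR ((K ∸ i) !) * natR (K C i))) * natR (K !) ⁻¹ ≈⟨ *-congʳ i!*[K∸i]!*KCi≈K! ⟩
    natR (K !) * natR (K !) ⁻¹                                      ≈⟨ ⁻¹-inverse _ (k!≉0 K) ⟩
    1#                                                              ∎)
    where
    i!*[K∸i]!*KCi≈K! : natR (i !) * (natR ((K ∸ i) !) * natR (K C i)) ≈ natR (K !)
    i!*[K∸i]!*KCi≈K! = begin
      natR (i !) * (natR ((K ∸ i) !) * natR (K C i))  ≈⟨ solve 3 (λ a b c → a :* (b :* c) := c :* (a :* b)) refl _ _ _ ⟩
      natR (K C i) * (natR (i !) * natR ((K ∸ i) !))  ≈⟨ trans (*-congˡ (sym (natR-homo-* (i !) ((K ∸ i) !)))) (sym (natR-homo-* (K C i) _)) ⟩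
      natR ((K C i) ℕ.* (i ! ℕ.* (K ∸ i) !))          ≡⟨ ≡.cong natR (nCk*k![n∸k]!≡n! i≤K) ⟩
      natR (K !)                                      ∎

  -- Multiplying the k-th β-recursion by n^(k+1) / (k+1)! turns its i-th term into b i C(n, k+1-i).
  β-term*scale : ∀ k i → i ≤ suc k → β-term k i * (pow (natR n) (suc k) * natR (suc k !) ⁻¹) ≈ b i * natR (n C (suc k ∸ i))
  β-term*scale k i i≤1+k = begin
    cᵢ * B i * φ j * (pow (natR n) (suc k) * F⁻¹)
      ≈⟨ *-congˡ (*-congʳ (trans (reflexive (≡.cong (pow (natR n)) (≡.sym (ℕ.m+[n∸m]≡n i≤1+k)))) (pow-homo-+ (natR n) i j))) ⟩
    cᵢ * B i * φ j * ((pow (natR n) i * pow (natR n) j) * F⁻¹)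
      ≈⟨ solve 6 (λ cᵢ B f Pi Pj F → cᵢ :* B :* f :* ((Pi :* Pj) :* F) := Pi :* B :* (f :* Pj) :* (cᵢ :* F)) refl cᵢ (B i) (φ j) (pow (natR n) i) (pow (natR n) j) F⁻¹ ⟩
    pow (natR n) i * B i * (φ j * pow (natR n) j) * (cᵢ * F⁻¹)
      ≈⟨ *-congʳ (*-congˡ (φ*n^j≈j!*nCj j)) ⟩
    pow (natR n) i * B i * (natR (j !) * natR (n C j)) * (cᵢ * F⁻¹)
      ≈⟨ solve 6 (λ P B J C cᵢ F → P :* B :* (J :* C) :* (cᵢ :* F) := P :* B :* (J :* cᵢ :* F) :* C) refl (pow (natR n) i) (B i) (natR (j !)) (natR (n C j)) cᵢ F⁻¹ ⟩
    pow (natR n) i * B i * (natR (j !) * cᵢ * F⁻¹) * natR (n C j)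
      ≈⟨ *-congʳ (*-congˡ ([K∸i]!*KCi*K!⁻¹≈i!⁻¹ i≤1+k)) ⟩
    b i * natR (n C j) ∎
    where
    j : ℕ
    j = suc k ∸ i
    cᵢ F⁻¹ : Carrier
    cᵢ = natR (suc k C i)
    F⁻¹ = natR (suc k !) ⁻¹

  b⋆ê≋δ : b ⋆ ê ≋ δ
  b⋆ê≋δ k = begin
    (b ⋆ ê) k
      ≈⟨ ⋆-as-Σ b ê k ⟩
    Σ (suc k) (λ i → b i * ê (k ∸ i))
      ≈⟨ Σ-cong< (suc k) {g = λ i → natR n ⁻¹ * (b i * natR (n C (suc k ∸ i)))} (λ i i≤k → reorder i (ℕ.≤-pred i≤k)) ⟩
    Σ (suc k) (λ i → natR n ⁻¹ * (b i * natR (n C (suc k ∸ i))))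
      ≈⟨ *-distribˡ-Σ (suc k) (natR n ⁻¹) (λ i → b i * natR (n C (suc k ∸ i))) ⟨
    natR n ⁻¹ * Σ (suc k) (λ i → b i * natR (n C (suc k ∸ i)))
      ≈⟨ *-congˡ (Σ-cong< (suc k) {g = λ i → β-term k i * scale} (λ i i≤k → sym (β-term*scale k i (ℕ.m≤n⇒m≤1+n (ℕ.≤-pred i≤k))))) ⟩
    natR n ⁻¹ * Σ (suc k) (λ i → β-term k i * scale)
      ≈⟨ *-congˡ (*-distribʳ-Σ (suc k) scale (β-term k)) ⟨
    natR n ⁻¹ * (Σ (suc k) (β-term k) * scale)
      ≈⟨ *-congˡ (*-congʳ (β-recursionᴷ k)) ⟩
    natR n ⁻¹ * (δ k * scale)
      ≈⟨ δ-case k ⟩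
    δ k ∎
    where
    scale : Carrier
    scale = pow (natR n) (suc k) * natR (suc k !) ⁻¹
    reorder : ∀ i → i ≤ k → b i * ê (k ∸ i) ≈ natR n ⁻¹ * (b i * natR (n C (suc k ∸ i)))
    reorder i i≤k = trans (solve 3 (λ b c m → b :* (c :* m) := m :* (b :* c)) refl (b i) _ _)
      (*-congˡ (*-congˡ (reflexive (≡.cong (λ z → natR (n C z)) (≡.sym (ℕ.+-∸-assoc 1 i≤k))))))
    δ-case : ∀ k → natR n ⁻¹ * (δ k * (pow (natR n) (suc k) * natR (suc k !) ⁻¹)) ≈ δ k
    δ-case zero    = begin
      natR n ⁻¹ * (1# * (natR n * 1# * natR 1 ⁻¹))
        ≈⟨ *-congˡ (*-congˡ (*-congˡ (trans (⁻¹-cong (char0 0) (+-identityʳ 1#)) 1#⁻¹≈1#))) ⟩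
      natR n ⁻¹ * (1# * (natR n * 1# * 1#))
        ≈⟨ solve 2 (λ a b → a :* (con (+ 1) :* (b :* con (+ 1) :* con (+ 1))) := b :* a) refl _ _ ⟩
      natR n * natR n ⁻¹                             ≈⟨ ⁻¹-inverse _ n≉0 ⟩
      1#                                             ∎
    δ-case (suc k) = trans (*-congˡ (zeroˡ _)) (zeroʳ _)

module PowerSums {c ℓ} (K : Char0Field c ℓ) (N : ℕ) (ζ : Char0Field.Carrier K)
                 (ζ-primitive : Char0Field.IsPrimitiveRoot K (suc N) ζ) where
  open Char0Field K
  open RingArithmetic cring
  open FieldArithmetic K
  open PowerSeries cring
  open SeriesSubstitution cring
  open BinomialQuotient K N
  open BinomialQuotientSeries K N
  open DegenerateBernoulliSeries K N
  open RootsOfUnity K N ζ ζ-primitive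
  open NewtonIdentities K N ζ ζ-primitive
  open RingSolver using (solve; _:+_; _:*_; :-_; _:-_; _:=_; con)
  open import Data.Integer using (+_)
  open import Relation.Binary.Reasoning.Setoid setoid

  -- V M = Σ_j C(M-1, j-1) n^j β_j(1/n) / j!, the inner sum of the theorem.
  V : Series
  V = substitute b

  V-zero : V 0 ≈ 1#
  V-zero = trans (substitute-zero b) (trans (sym (trans (*-congˡ ê-zero) (*-identityʳ _))) (b⋆ê≋δ 0))

  newton-sum≈⋆ : ∀ a M → newton-sum a (suc M) 1 ≈ (alternate (λ t → p (a ℕ.+ t) 1) ⋆ (λ k → e k 1)) M
  newton-sum≈⋆ a zero    = trans (trans (+-congˡ -0#≈0#) (+-identityʳ _)) (*-congʳ (sym (trans (*-identityˡ _) (reflexive (≡.cong (λ z → p z 1) (ℕ.+-identityʳ a))))))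
    where open import Algebra.Properties.Ring ring using (-0#≈0#)
  newton-sum≈⋆ a (suc M) = begin
    p a 1 * e (suc M) 1 - newton-sum (suc a) (suc M) 1
      ≈⟨ +-congˡ (-‿cong (newton-sum≈⋆ (suc a) M)) ⟩
    p a 1 * e (suc M) 1 - (alternate (λ t → p (suc a ℕ.+ t) 1) ⋆ E) M
      ≈⟨ +-cong (*-congʳ (sym (trans (*-identityˡ _) (reflexive (≡.cong (λ z → p z 1) (ℕ.+-identityʳ a))))))
                (sym (⋆-negˡ (alternate (λ t → p (suc a ℕ.+ t) 1)) E M)) ⟩
    alternate (λ t → p (a ℕ.+ t) 1) 0 * e (suc M) 1 + ((⊝ alternate (λ t → p (suc a ℕ.+ t) 1)) ⋆ E) M
      ≈⟨ +-congˡ (⋆-cong shift (λ _ → refl) M) ⟩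
    (alternate (λ t → p (a ℕ.+ t) 1) ⋆ E) (suc M) ∎
    where
    E : Series
    E k = e k 1
    shift : ⊝ alternate (λ t → p (suc a ℕ.+ t) 1) ≋ alternate (λ t → p (a ℕ.+ t) 1) ∘ suc
    shift t = sym (trans (*-cong (sgn-suc t) (reflexive (≡.cong (λ z → p z 1) (ℕ.+-suc a t)))) (sym (-‿distribˡ-* _ _)))
      where open import Algebra.Properties.Ring ring using (-‿distribˡ-*)

  alternate-V∘suc⋆ê : ∀ M → (alternate (V ∘ suc) ⋆ ê) M ≈ ê (suc M) - natR (N C suc M)
  alternate-V∘suc⋆ê M = begin
    Y                                                      ≈⟨ trans (*-congʳ (sgn*sgn M)) (*-identityˡ _) ⟨
    (s * s) * Y                                            ≈⟨ *-assoc _ _ _ ⟩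
    s * (s * Y)                                            ≈⟨ *-congˡ (alternate-⋆ (alternate (V ∘ suc)) ê M) ⟨
    s * (alternate (alternate (V ∘ suc)) ⋆ alternate ê) M  ≈⟨ *-congˡ (⋆-cong unalternate (λ _ → refl) M) ⟩
    s * ((V ∘ suc) ⋆ alternate ê) M                        ≈⟨ *-congˡ (solve 2 (λ a b → b := (a :+ b) :- a) refl (V 0 * alternate ê (suc M)) _) ⟩
    s * ((V ⋆ alternate ê) (suc M) - V 0 * alternate ê (suc M))
      ≈⟨ *-congˡ (+-cong (trans (substitute-inverse⋆ê[-X] b b⋆ê≋δ (suc M)) (alternating-binomial-series N (suc M)))
                         (-‿cong (*-cong V-zero (*-congʳ (sgn-suc M))))) ⟩
    s * (sgn (suc M) * natR (N C suc M) - 1# * (- s * ê (suc M)))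
      ≈⟨ *-congˡ (+-congʳ (*-congʳ (sgn-suc M))) ⟩
    s * (- s * natR (N C suc M) - 1# * (- s * ê (suc M)))
      ≈⟨ solve 3 (λ s c e → s :* ((:- s) :* c :- con (+ 1) :* ((:- s) :* e)) := (s :* s) :* (e :- c)) refl s _ _ ⟩
    (s * s) * (ê (suc M) - natR (N C suc M))              ≈⟨ trans (*-congʳ (sgn*sgn M)) (*-identityˡ _) ⟩
    ê (suc M) - natR (N C suc M)                           ∎
    where
    s Y : Carrier
    s = sgn M
    Y = (alternate (V ∘ suc) ⋆ ê) M
    unalternate : alternate (alternate (V ∘ suc)) ≋ V ∘ suc
    unalternate t = trans (sym (*-assoc _ _ _)) (trans (*-congʳ (sgn*sgn t)) (*-identityˡ _))

  -- p (t + 1) + V (t + 1) satisfies Newton's identities with right-hand side 0.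
  power-sum : ∀ t → p (suc t) 1 ≈ - V (suc t)
  power-sum t = begin
    p (suc t) 1                          ≈⟨ solve 2 (λ a b → a := (a :+ b) :- b) refl _ _ ⟩
    (p (suc t) 1 + V (suc t)) - V (suc t) ≈⟨ +-congʳ (x*y≈0⇒y≈0 sgn≉0 (⋆-unit-cancelʳ g E refl g⋆E≋0 t)) ⟩
    0# - V (suc t)                       ≈⟨ +-identityˡ _ ⟩
    - V (suc t)                          ∎
    where
    E : Series
    E k = e k 1
    g : Series
    g t = sgn t * (p (suc t) 1 + V (suc t))
    sgn≉0 : ¬ (sgn t ≈ 0#)
    sgn≉0 sgn≈0 = 1#≉0# (trans (sym (sgn*sgn t)) (trans (*-congʳ sgn≈0) (zeroˡ _)))
    g⋆E≋0 : g ⋆ E ≋ 0ₛ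
    g⋆E≋0 M = begin
      (g ⋆ E) M
        ≈⟨ ⋆-cong {g′ = ê} (λ t → distribˡ _ _ _) elementary-symmetric M ⟩
      ((alternate (λ t → p (1 ℕ.+ t) 1) ⊕ alternate (V ∘ suc)) ⋆ ê) M
        ≈⟨ ⋆-distribʳ-⊕ ê (alternate (λ t → p (1 ℕ.+ t) 1)) (alternate (V ∘ suc)) M ⟩
      (alternate (λ t → p (1 ℕ.+ t) 1) ⋆ ê) M + (alternate (V ∘ suc) ⋆ ê) M
        ≈⟨ +-cong (⋆-cong {alternate (λ t → p (1 ℕ.+ t) 1)} (λ _ → refl) (λ k → sym (elementary-symmetric k)) M) (alternate-V∘suc⋆ê M) ⟩
      (alternate (λ t → p (1 ℕ.+ t) 1) ⋆ E) M + (ê (suc M) - natR (N C suc M))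
        ≈⟨ +-congʳ (newton-sum≈⋆ 1 M) ⟨
      newton-sum 1 (suc M) 1 + (ê (suc M) - natR (N C suc M))
        ≈⟨ +-congʳ (trans (*-congˡ (sym (elementary-symmetric (suc M)))) (newton-identity (suc M))) ⟨
      natR (suc M) * ê (suc M) + (ê (suc M) - natR (N C suc M))
        ≈⟨ solve 3 (λ m e c → m :* e :+ (e :- c) := (con (+ 1) :+ m) :* e :- c) refl (natR (suc M)) _ _ ⟩
      natR (suc (suc M)) * ê (suc M) - natR (N C suc M)
        ≈⟨ +-congʳ ([1+k]*ê≈NCk (suc M)) ⟩
      natR (N C suc M) - natR (N C suc M)
        ≈⟨ -‿inverseʳ _ ⟩
      0# ∎

-- The explicit formula

module ExplicitFormula {c ℓ} (K : Char0Field c ℓ) (N : ℕ) (ζ : Char0Field.Carrier K)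
                (ζ-primitive : Char0Field.IsPrimitiveRoot K (suc N) ζ) where
  open Char0Field K
  open RingArithmetic cring
  open FiniteSums cring
  open FieldArithmetic K
  open RationalEmbedding K
  open PowerSeries cring
  open BinomialQuotient K N
  open DegenerateBernoulliSeries K N
  open RootsOfUnity K N ζ ζ-primitive
  open NewtonIdentities K N ζ ζ-primitive
  open PowerSums K N ζ ζ-primitive
  open RingSolver using (Polynomial; solve; _:+_; _:*_; :-_; _:-_; _:=_; con)
  open import Algebra.Properties.Ring ring using (-‿involutive; -0#≈0#)
  open import Relation.Binary.Reasoning.Setoid setoid

  lhs≈newton-sum : ∀ m A → sumR (map (λ j → ℨ (suc N) ζ (expo m A j)) (upTo m)) ≈ newton-sum A m 1
  lhs≈newton-sum m A = begin
    sumR (map (λ j → ℨ (suc N) ζ (expo m A j)) (upTo m))   ≈⟨ sumR-map-upTo m (λ j → Z 1 (expo m A j)) ⟩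
    Σ m (λ j → Z 1 (expo m A j))                     ≈⟨ Σ-cong m (λ j → reflexive (≡.cong (Z 1) (List.map-upTo _ m))) ⟩
    spread-sum A m 1                                 ≈⟨ spread-sum≈newton-sum 1 A m ⟩
    newton-sum A m 1                                 ∎

  -- Unroll newton-sum (A + 1) m = p A * e m - newton-sum A (m + 1) down to
  -- newton-sum 1 M = M * e M, keeping the p 1 term apart.
  newton-sum-unrolled : ∀ a m → newton-sum (suc (suc a)) m 1 ≈
    Σ a (λ k → sgn k * p (suc a ∸ k) 1 * e (m ℕ.+ k) 1)
    + sgn (suc a) * (natR (m ℕ.+ suc a) * e (m ℕ.+ suc a) 1 - p 1 1 * e (m ℕ.+ a) 1)
  newton-sum-unrolled zero m = begin
    newton-sum 2 m 1                                            ≈⟨ solve 2 (λ a b → b := a :- (a :- b)) refl (p 1 1 * e m 1) _ ⟩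
    p 1 1 * e m 1 - newton-sum 1 (suc m) 1                      ≈⟨ +-congˡ (-‿cong (newton-identity (suc m))) ⟨
    p 1 1 * e m 1 - natR (suc m) * e (suc m) 1
      ≈⟨ solve 3 (λ a b c → a :* b :- c := con (+ 0) :+ (:- con (+ 1)) :* (c :- a :* b)) refl (p 1 1) (e m 1) _ ⟩
    0# + - 1# * (natR (suc m) * e (suc m) 1 - p 1 1 * e m 1)
      ≈⟨ +-congˡ (*-cong (sym (*-identityʳ _)) (+-cong (reflexive (≡.cong (λ k → natR k * e k 1) (ℕ.+-comm 1 m)))
                                                        (-‿cong (*-congˡ (reflexive (≡.cong (λ k → e k 1) (≡.sym (ℕ.+-identityʳ m)))))))) ⟩
    0# + sgn 1 * (natR (m ℕ.+ 1) * e (m ℕ.+ 1) 1 - p 1 1 * e (m ℕ.+ 0) 1) ∎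
  newton-sum-unrolled (suc a) m = begin
    newton-sum (suc (suc (suc a))) m 1
      ≈⟨ solve 2 (λ a b → b := a :- (a :- b)) refl P _ ⟩
    P - newton-sum (suc (suc a)) (suc m) 1
      ≈⟨ +-congˡ (-‿cong (newton-sum-unrolled a (suc m))) ⟩
    P - (Σ a (λ k → sgn k * p (suc a ∸ k) 1 * e (suc m ℕ.+ k) 1) + sgn (suc a) * R′)
      ≈⟨ +-congˡ (-‿cong (+-cong (Σ-cong a (λ k → *-congˡ (reflexive (≡.cong (λ i → e i 1) (≡.sym (ℕ.+-suc m k))))))
                                  (*-congˡ (reflexive (≡.cong₂ (λ i j → natR i * e i 1 - p 1 1 * e j 1) (≡.sym (ℕ.+-suc m (suc a))) (≡.sym (ℕ.+-suc m a))))))) ⟩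
    P - (Σ a (λ k → sgn k * p (suc a ∸ k) 1 * e (m ℕ.+ suc k) 1) + sgn (suc a) * R)
      ≈⟨ solve 4 (λ P S s R → P :- (S :+ s :* R) := (P :+ (:- S)) :+ (:- s) :* R) refl P _ (sgn (suc a)) R ⟩
    (P + - Σ a (λ k → sgn k * p (suc a ∸ k) 1 * e (m ℕ.+ suc k) 1)) + - sgn (suc a) * R
      ≈⟨ +-cong (+-cong (*-congʳ (sym (*-identityˡ _)))
                        (trans (-‿distrib-Σ a _) (Σ-cong a (λ k → trans (-‿distribˡ-* _ _) (*-congʳ (trans (-‿distribˡ-* _ _) (*-congʳ (sym (sgn-suc k)))))))))
                (*-congʳ (sym (sgn-suc (suc a)))) ⟩
    (1# * p (suc (suc a)) 1 * e m 1 + Σ a (λ k → sgn (suc k) * p (suc (suc a) ∸ suc k) 1 * e (m ℕ.+ suc k) 1)) + sgn (suc (suc a)) * R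
      ≈⟨ +-congʳ (+-congʳ (*-congˡ (reflexive (≡.cong (λ i → e i 1) (≡.sym (ℕ.+-identityʳ m)))))) ⟩
    Σ (suc a) (λ k → sgn k * p (suc (suc a) ∸ k) 1 * e (m ℕ.+ k) 1) + sgn (suc (suc a)) * R ∎
    where
    open import Algebra.Properties.Ring ring using (-‿distribˡ-*)
    P R′ R : Carrier
    P = p (suc (suc a)) 1 * e m 1
    R′ = natR (suc m ℕ.+ suc a) * e (suc m ℕ.+ suc a) 1 - p 1 1 * e (suc m ℕ.+ a) 1
    R = natR (m ℕ.+ suc (suc a)) * e (m ℕ.+ suc (suc a)) 1 - p 1 1 * e (m ℕ.+ suc a) 1

  p₁≈ê₁ : p 1 1 ≈ ê 1
  p₁≈ê₁ = begin
    p 1 1                ≈⟨ solve 1 (λ a → a := a :* con (+ 1) :- con (+ 0)) refl _ ⟩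
    p 1 1 * 1# - 0#      ≈⟨ newton-identity 1 ⟨
    natR 1 * e 1 1       ≈⟨ trans (*-congʳ (+-identityʳ 1#)) (*-identityˡ _) ⟩
    e 1 1                ≈⟨ elementary-symmetric 1 ⟩
    ê 1                  ∎

  Σp*e≈Σê*V : ∀ a m → Σ a (λ k → sgn k * p (suc a ∸ k) 1 * e (m ℕ.+ k) 1) ≈ Σ a (λ k → sgn (suc k) * ê (m ℕ.+ k) * V (suc (a ∸ k)))
  Σp*e≈Σê*V a m = Σ-cong< a (λ k k<a → begin
    sgn k * p (suc a ∸ k) 1 * e (m ℕ.+ k) 1
      ≈⟨ *-cong (*-congˡ (trans (reflexive (≡.cong (λ z → p z 1) (ℕ.+-∸-assoc 1 (ℕ.<⇒≤ k<a)))) (power-sum (a ∸ k)))) (elementary-symmetric (m ℕ.+ k)) ⟩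
    sgn k * - V (suc (a ∸ k)) * ê (m ℕ.+ k)
      ≈⟨ solve 3 (λ s v e → s :* (:- v) :* e := (:- s) :* e :* v) refl (sgn k) _ _ ⟩
    - sgn k * ê (m ℕ.+ k) * V (suc (a ∸ k))
      ≈⟨ *-congʳ (*-congʳ (sgn-suc k)) ⟨
    sgn (suc k) * ê (m ℕ.+ k) * V (suc (a ∸ k)) ∎)

  -- The second line of the theorem, with M = m + a = m + A - 2.
  boundary : ℕ → ℕ → Carrier
  boundary a m = sgn (suc a) * natR M * (natR N - natR 2 * natR M - natR 2)
                 * (natR 2 * natR (suc M) * natR (suc (suc M))) ⁻¹ * natR (N C M)
    where M = m ℕ.+ a

  boundary-cleared : ∀ M → (natR (suc M) * ê (suc M) - ê 1 * ê M) * (natR 2 * natR (suc M) * natR (suc (suc M)))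
                           ≈ natR M * (natR N - natR 2 * natR M - natR 2) * natR (N C M)
  boundary-cleared M = begin
    (s * ê (suc M) - ê 1 * ê M) * (two * s * s′)
      ≈⟨ solve 6 (λ t σ σ′ e′ e₁ e → (σ :* e′ :- e₁ :* e) :* (t :* σ :* σ′) := t :* σ :* σ :* (e′ :* σ′) :- σ′ :* (e₁ :* t) :* (e :* σ))
                 refl two s s′ (ê (suc M)) (ê 1) (ê M) ⟩
    two * s * s * (ê (suc M) * s′) - s′ * (ê 1 * two) * (ê M * s)
      ≈⟨ +-cong (*-congˡ (trans (*-comm _ _) ([1+k]*ê≈NCk (suc M)))) (-‿cong (*-cong (*-congˡ ê₁*2≈N) (trans (*-comm _ _) ([1+k]*ê≈NCk M)))) ⟩
    two * s * s * Γ′ - s′ * natR N * Γ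
      ≈⟨ solve 6 (λ t σ γ′ μ γ x → t :* σ :* σ :* γ′ :- x := t :* σ :* (σ :* γ′ :+ μ :* γ) :- t :* σ :* μ :* γ :- x)
                 refl two s Γ′ (natR M) Γ (s′ * natR N * Γ) ⟩
    two * s * (s * Γ′ + natR M * Γ) - two * s * natR M * Γ - s′ * natR N * Γ
      ≈⟨ +-congʳ (+-congʳ (*-congˡ absorption)) ⟩
    two * s * (natR N * Γ) - two * s * natR M * Γ - s′ * natR N * Γ
      ≈⟨ solve 3 (λ μ ν γ → two′ :* (con (+ 1) :+ μ) :* (ν :* γ) :- two′ :* (con (+ 1) :+ μ) :* μ :* γ :- (con (+ 1) :+ (con (+ 1) :+ μ)) :* ν :* γ
                            := μ :* (ν :- two′ :* μ :- two′) :* γ) refl (natR M) (natR N) Γ ⟩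
    natR M * (natR N - two * natR M - two) * Γ ∎
    where
    s s′ two Γ Γ′ : Carrier
    s = natR (suc M)
    s′ = natR (suc (suc M))
    two = natR 2
    Γ = natR (N C M)
    Γ′ = natR (N C suc M)
    two′ : ∀ {k} → Polynomial k
    two′ = con (+ 1) :+ (con (+ 1) :+ con (+ 0))
    ê₁*2≈N : ê 1 * two ≈ natR N
    ê₁*2≈N = trans (*-comm _ _) (trans ([1+k]*ê≈NCk 1) (reflexive (≡.cong natR (nC1≡n N))))
    absorption : s * Γ′ + natR M * Γ ≈ natR N * Γ
    absorption = begin
      s * Γ′ + natR M * Γ                                 ≈⟨ +-cong (natR-homo-* (suc M) (N C suc M)) (natR-homo-* M (N C M)) ⟨
      natR (suc M ℕ.* (N C suc M)) + natR (M ℕ.* (N C M)) ≈⟨ natR-homo-+ (suc M ℕ.* (N C suc M)) (M ℕ.* (N C M)) ⟨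
      natR (suc M ℕ.* (N C suc M) ℕ.+ M ℕ.* (N C M))      ≡⟨ ≡.cong natR ([1+k]*nC[1+k]+k*nCk≡n*nCk N M) ⟩
      natR (N ℕ.* (N C M))                                ≈⟨ natR-homo-* N (N C M) ⟩
      natR N * Γ                                          ∎

  boundary-closed-form : ∀ a m → sgn (suc a) * (natR (m ℕ.+ suc a) * ê (m ℕ.+ suc a) - ê 1 * ê (m ℕ.+ a)) ≈ boundary a m
  boundary-closed-form a m = begin
    sgn (suc a) * (natR (m ℕ.+ suc a) * ê (m ℕ.+ suc a) - ê 1 * ê M)
      ≡⟨ ≡.cong (λ k → sgn (suc a) * (natR k * ê k - ê 1 * ê M)) (ℕ.+-suc m a) ⟩
    sgn (suc a) * (natR (suc M) * ê (suc M) - ê 1 * ê M)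
      ≈⟨ *-congˡ (x*y≈z⇒x≈z*y⁻¹ D≉0 (boundary-cleared M)) ⟩
    sgn (suc a) * ((natR M * W * natR (N C M)) * D ⁻¹)
      ≈⟨ solve 5 (λ σ μ ω γ δ → σ :* ((μ :* ω :* γ) :* δ) := σ :* μ :* ω :* δ :* γ) refl (sgn (suc a)) (natR M) W (natR (N C M)) (D ⁻¹) ⟩
    boundary a m ∎
    where
    M : ℕ
    M = m ℕ.+ a
    W D : Carrier
    W = natR N - natR 2 * natR M - natR 2
    D = natR 2 * natR (suc M) * natR (suc (suc M))
    D≉0 : ¬ (D ≈ 0#)
    D≉0 = *-≉0 (*-≉0 (char0 1) (char0 M)) (char0 (suc M))

  ê≈NCk*[1+k]⁻¹ : ∀ k → ê k ≈ natR (N C k) * natR (suc k) ⁻¹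
  ê≈NCk*[1+k]⁻¹ k = x*y≈z⇒x≈z*y⁻¹ (char0 k) (trans (*-comm _ _) ([1+k]*ê≈NCk k))

  rhs-summand : ℕ → ℕ → ℕ → ℕ → ℚ
  rhs-summand m A k j =
    (sign (suc k) ℚ.* powℚ (ℕtoℚ (suc N)) j ℚ.* β (+ 1 ℚ./ suc (suc N ∸ 1)) j ÷ℕ ((m ℕ.+ k ℕ.+ 1) ℕ.* (j !)))
    ℚ.* ℕtoℚ ((suc N ∸ 1) C (m ℕ.+ k)) ℚ.* ℕtoℚ ((A ∸ k ∸ 2) C (j ∸ 1))

  ι-rhs-summand : ∀ m A k j → ι (rhs-summand m A k j) ≈ sgn (suc k) * ê (m ℕ.+ k) * (natR ((A ∸ k ∸ 2) C (j ∸ 1)) * b j)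
  ι-rhs-summand m A k j = begin
    ι (rhs-summand m A k j)
      ≈⟨ trans (ι-homo-* (q ℚ.* ℕtoℚ (N C (m ℕ.+ k))) (ℕtoℚ Cⱼ)) (*-cong (ι-homo-* q (ℕtoℚ (N C (m ℕ.+ k)))) (ι-ℕtoℚ Cⱼ)) ⟩
    ι q * ι (ℕtoℚ (N C (m ℕ.+ k))) * natR Cⱼ
      ≈⟨ *-congʳ (*-cong ι-q (ι-ℕtoℚ (N C (m ℕ.+ k)))) ⟩
    (sgn (suc k) * pow (natR n) j * (B j * (natR (suc (m ℕ.+ k)) ⁻¹ * natR (j !) ⁻¹))) * natR (N C (m ℕ.+ k)) * natR Cⱼ
      ≈⟨ solve 7 (λ σ ν β μ φ γ γⱼ → σ :* ν :* (β :* (μ :* φ)) :* γ :* γⱼ := σ :* (γ :* μ) :* (γⱼ :* (ν :* β :* φ))) refl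
               (sgn (suc k)) (pow (natR n) j) (B j) (natR (suc (m ℕ.+ k)) ⁻¹) (natR (j !) ⁻¹) (natR (N C (m ℕ.+ k))) (natR Cⱼ) ⟩
    sgn (suc k) * (natR (N C (m ℕ.+ k)) * natR (suc (m ℕ.+ k)) ⁻¹) * (natR Cⱼ * b j)
      ≈⟨ *-congʳ (*-congˡ (ê≈NCk*[1+k]⁻¹ (m ℕ.+ k))) ⟨
    sgn (suc k) * ê (m ℕ.+ k) * (natR Cⱼ * b j) ∎
    where
    D Cⱼ : ℕ
    D = (m ℕ.+ k ℕ.+ 1) ℕ.* (j !)
    Cⱼ = (A ∸ k ∸ 2) C (j ∸ 1)
    q : ℚ
    q = sign (suc k) ℚ.* powℚ (ℕtoℚ (suc N)) j ℚ.* (β 1/n j ÷ℕ D)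
    D≢0 : D ≢ 0
    D≢0 D≡0 with ≡.subst (1 ≤_) D≡0 (ℕ.*-mono-≤ (ℕ.m≤n+m 1 (m ℕ.+ k)) (ℕ.1≤n! j))
    ... | ()
    D⁻¹≈ : natR D ⁻¹ ≈ natR (suc (m ℕ.+ k)) ⁻¹ * natR (j !) ⁻¹
    D⁻¹≈ = trans (⁻¹-cong (natR≉0# D≢0) (trans (natR-homo-* (m ℕ.+ k ℕ.+ 1) (j !)) (*-congʳ (reflexive (≡.cong natR (ℕ.+-comm (m ℕ.+ k) 1))))))
                 (⁻¹-distrib-* (char0 (m ℕ.+ k)) (k!≉0 j))
    ι-q : ι q ≈ sgn (suc k) * pow (natR n) j * (B j * (natR (suc (m ℕ.+ k)) ⁻¹ * natR (j !) ⁻¹))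
    ι-q = begin
      ι q
        ≈⟨ ι-homo-* (sign (suc k) ℚ.* powℚ (ℕtoℚ (suc N)) j) (β 1/n j ÷ℕ D) ⟩
      ι (sign (suc k) ℚ.* powℚ (ℕtoℚ (suc N)) j) * ι (β 1/n j ÷ℕ D)
        ≈⟨ *-cong (trans (ι-homo-* (sign (suc k)) (powℚ (ℕtoℚ (suc N)) j)) (*-cong (ι-sign (suc k)) (trans (ι-powℚ (ℕtoℚ (suc N)) j) (pow-cong j (ι-ℕtoℚ (suc N))))))
                  (ι-÷ℕ (β 1/n j) D≢0) ⟩
      sgn (suc k) * pow (natR n) j * (B j * natR D ⁻¹)
        ≈⟨ *-congˡ (*-congˡ D⁻¹≈) ⟩
      sgn (suc k) * pow (natR n) j * (B j * (natR (suc (m ℕ.+ k)) ⁻¹ * natR (j !) ⁻¹)) ∎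

  ι-rhs-inner : ∀ a m k → k ≤ a →
    ι (sumℚ (map (rhs-summand m (suc (suc a)) k) (map suc (upTo (suc (suc a) ∸ k ∸ 1))))) ≈ sgn (suc k) * ê (m ℕ.+ k) * V (suc (a ∸ k))
  ι-rhs-inner a m k k≤a =
    trans (ι-sumℚ-map-suc-upTo ((suc (suc a)) ∸ k ∸ 1) (rhs-summand m (suc (suc a)) k))
    (trans (reflexive (≡.cong (λ L → Σ L (λ j → ι (rhs-summand m (suc (suc a)) k (suc j)))) A∸k∸1≡1+a∸k))
    (trans (Σ-cong (suc (a ∸ k)) {f = λ j → ι (rhs-summand m (suc (suc a)) k (suc j))}
                                  {g = λ j → sgn (suc k) * ê (m ℕ.+ k) * (natR ((a ∸ k) C j) * b (suc j))}
                                  (λ j → trans (ι-rhs-summand m (suc (suc a)) k (suc j)) (*-congˡ (*-congʳ (reflexive (≡.cong (λ z → natR (z C j)) A∸k∸2≡a∸k))))))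
    (trans (sym (*-distribˡ-Σ (suc (a ∸ k)) (sgn (suc k) * ê (m ℕ.+ k)) (λ j → natR ((a ∸ k) C j) * b (suc j))))
           (*-congˡ (sym (trans (+-congʳ (zeroˡ (b 0))) (+-identityˡ _)))))))
    where
    A∸k∸2≡a∸k : (suc (suc a)) ∸ k ∸ 2 ≡ a ∸ k
    A∸k∸2≡a∸k = ≡.cong (_∸ 2) (ℕ.+-∸-assoc 2 k≤a)
    A∸k∸1≡1+a∸k : (suc (suc a)) ∸ k ∸ 1 ≡ suc (a ∸ k)
    A∸k∸1≡1+a∸k = ≡.cong (_∸ 1) (ℕ.+-∸-assoc 2 k≤a)

  rhs-last : ℕ → ℕ → ℚ
  rhs-last m A =
    ((sign (suc A) ℚ.* ℕtoℚ (m ℕ.+ A ∸ 2) ℚ.* ℤtoℚ (+ suc N ℤ.- + (2 ℕ.* m ℕ.+ 2 ℕ.* A) ℤ.+ + 1))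
       ÷ℕ (2 ℕ.* (m ℕ.+ A ∸ 1) ℕ.* (m ℕ.+ A)))
    ℚ.* ℕtoℚ ((suc N ∸ 1) C (m ℕ.+ A ∸ 2))

  rhs-split : ∀ m A → rhs (suc N) m A ≡
    sumℚ (map (λ k → sumℚ (map (rhs-summand m A k) (map suc (upTo (A ∸ k ∸ 1))))) (upTo (A ∸ 2))) ℚ.+ rhs-last m A
  rhs-split m A = ≡.refl

  ι-rhs-last : ∀ m A → 2 ℕ.* (m ℕ.+ A ∸ 1) ℕ.* (m ℕ.+ A) ≢ 0 →
    ι (rhs-last m A) ≈ sgn (suc A) * natR (m ℕ.+ A ∸ 2) * intR (+ suc N ℤ.- + (2 ℕ.* m ℕ.+ 2 ℕ.* A) ℤ.+ + 1)
                       * natR (2 ℕ.* (m ℕ.+ A ∸ 1) ℕ.* (m ℕ.+ A)) ⁻¹ * natR (N C (m ℕ.+ A ∸ 2))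
  ι-rhs-last m A d≢0 =
    trans (ι-homo-* (y ÷ℕ d) (ℕtoℚ (N C (m ℕ.+ A ∸ 2))))
    (*-cong (trans (ι-÷ℕ y d≢0)
                   (*-congʳ (trans (ι-homo-* (sign (suc A) ℚ.* ℕtoℚ (m ℕ.+ A ∸ 2)) (ℤtoℚ z))
                                   (*-cong (trans (ι-homo-* (sign (suc A)) (ℕtoℚ (m ℕ.+ A ∸ 2))) (*-cong (ι-sign (suc A)) (ι-ℕtoℚ (m ℕ.+ A ∸ 2))))
                                           (ι-ℤtoℚ z)))))
            (ι-ℕtoℚ (N C (m ℕ.+ A ∸ 2))))
    where
    z : ℤ
    z = + suc N ℤ.- + (2 ℕ.* m ℕ.+ 2 ℕ.* A) ℤ.+ + 1
    y : ℚ
    y = sign (suc A) ℚ.* ℕtoℚ (m ℕ.+ A ∸ 2) ℚ.* ℤtoℚ z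
    d : ℕ
    d = 2 ℕ.* (m ℕ.+ A ∸ 1) ℕ.* (m ℕ.+ A)

  ι-rhs-last≈boundary : ∀ a m → ι (rhs-last m (suc (suc a))) ≈ boundary a m
  ι-rhs-last≈boundary a m = begin
    ι (rhs-last m (suc (suc a)))
      ≈⟨ ι-rhs-last m (suc (suc a)) d≢0 ⟩
    sgn (suc (suc (suc a))) * natR (m ℕ.+ (suc (suc a)) ∸ 2) * intR z * natR d ⁻¹ * natR (N C (m ℕ.+ (suc (suc a)) ∸ 2))
      ≡⟨ ≡.cong (λ k → sgn (suc (suc (suc a))) * natR k * intR z * natR d ⁻¹ * natR (N C k)) m+A∸2≡M ⟩
    sgn (suc (suc (suc a))) * natR M * intR z * natR d ⁻¹ * natR (N C M)
      ≈⟨ *-congʳ (*-cong (*-cong (*-congʳ sgn[3+a]≈sgn[1+a]) intR-z) d⁻¹≈) ⟩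
    boundary a m ∎
    where
    M : ℕ
    M = m ℕ.+ a
    z : ℤ
    z = + suc N ℤ.- + (2 ℕ.* m ℕ.+ 2 ℕ.* (suc (suc a))) ℤ.+ + 1
    d : ℕ
    d = 2 ℕ.* (m ℕ.+ (suc (suc a)) ∸ 1) ℕ.* (m ℕ.+ (suc (suc a)))
    m+A≡2+M : m ℕ.+ (suc (suc a)) ≡ 2 ℕ.+ M
    m+A≡2+M = ≡.trans (ℕ.+-suc m (suc a)) (≡.cong suc (ℕ.+-suc m a))
    m+A∸2≡M : m ℕ.+ (suc (suc a)) ∸ 2 ≡ M
    m+A∸2≡M = ≡.cong (_∸ 2) m+A≡2+M
    d≡ : d ≡ 2 ℕ.* suc M ℕ.* suc (suc M)
    d≡ = ≡.cong₂ (λ u v → 2 ℕ.* u ℕ.* v) (≡.cong (_∸ 1) m+A≡2+M) m+A≡2+M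
    sgn[3+a]≈sgn[1+a] : sgn (suc (suc (suc a))) ≈ sgn (suc a)
    sgn[3+a]≈sgn[1+a] = trans (sgn-suc (suc (suc a))) (trans (-‿cong (sgn-suc (suc a))) (-‿involutive _))
    d≢0 : d ≢ 0
    d≢0 d≡0 = ℕ.0≢1+n (≡.trans (≡.sym d≡0) d≡)
    d⁻¹≈ : natR d ⁻¹ ≈ (natR 2 * natR (suc M) * natR (suc (suc M))) ⁻¹
    d⁻¹≈ = ⁻¹-cong (natR≉0# d≢0)
             (trans (reflexive (≡.cong natR d≡)) (trans (natR-homo-* (2 ℕ.* suc M) (suc (suc M))) (*-congʳ (natR-homo-* 2 (suc M)))))
    intR-z : intR z ≈ natR N - natR 2 * natR M - natR 2
    intR-z = begin
      intR z
        ≈⟨ intR-homo-+ (+ suc N ℤ.- + 2m+2A) (+ 1) ⟩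
      intR (+ suc N ℤ.- + 2m+2A) + natR 1
        ≈⟨ +-congʳ (trans (intR-homo-+ (+ suc N) (ℤ.- + 2m+2A)) (+-congˡ (intR-homo-neg (+ 2m+2A)))) ⟩
      natR n - natR 2m+2A + natR 1
        ≈⟨ +-congʳ (+-congˡ (-‿cong (trans (natR-homo-+ (2 ℕ.* m) (2 ℕ.* suc (suc a))) (+-cong (natR-homo-* 2 m) (natR-homo-* 2 (suc (suc a))))))) ⟩
      natR n - (natR 2 * natR m + natR 2 * natR (suc (suc a))) + natR 1
        ≈⟨ solve 3 (λ ν μ α → (con (+ 1) :+ ν) :- (two :* μ :+ two :* (con (+ 1) :+ (con (+ 1) :+ α))) :+ (con (+ 1) :+ con (+ 0))
                              := ν :- two :* (μ :+ α) :- two) refl (natR N) (natR m) (natR a) ⟩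
      natR N - natR 2 * (natR m + natR a) - natR 2
        ≈⟨ +-congʳ (+-congˡ (-‿cong (*-congˡ (natR-homo-+ m a)))) ⟨
      natR N - natR 2 * natR M - natR 2 ∎
      where
      2m+2A : ℕ
      2m+2A = 2 ℕ.* m ℕ.+ 2 ℕ.* suc (suc a)
      two : ∀ {k} → Polynomial k
      two = con (+ 1) :+ (con (+ 1) :+ con (+ 0))

  ι-rhs : ∀ a m → ι (rhs (suc N) m (suc (suc a))) ≈ Σ a (λ k → sgn (suc k) * ê (m ℕ.+ k) * V (suc (a ∸ k))) + boundary a m
  ι-rhs a m =
    trans (reflexive (≡.cong ι (rhs-split m (suc (suc a)))))
    (trans (ι-homo-+ (sumℚ (map inner (upTo a))) (rhs-last m (suc (suc a))))
           (+-cong (trans (ι-sumℚ-map-upTo a inner) (Σ-cong< a (λ k k<a → ι-rhs-inner a m k (ℕ.<⇒≤ k<a))))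
                   (ι-rhs-last≈boundary a m)))
    where
    inner : ℕ → ℚ
    inner k = sumℚ (map (rhs-summand m (suc (suc a)) k) (map suc (upTo (suc (suc a) ∸ k ∸ 1))))

  lhs≈ι-rhs : ∀ a m → sumR (map (λ j → ℨ (suc N) ζ (expo m (suc (suc a)) j)) (upTo m)) ≈ ι (rhs (suc N) m (suc (suc a)))
  lhs≈ι-rhs a m = begin
    sumR (map (λ j → ℨ (suc N) ζ (expo m (suc (suc a)) j)) (upTo m))
      ≈⟨ lhs≈newton-sum m (suc (suc a)) ⟩
    newton-sum (suc (suc a)) m 1
      ≈⟨ newton-sum-unrolled a m ⟩
    Σ a (λ k → sgn k * p (suc a ∸ k) 1 * e (m ℕ.+ k) 1) + sgn (suc a) * (natR (m ℕ.+ suc a) * e (m ℕ.+ suc a) 1 - p 1 1 * e (m ℕ.+ a) 1)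
      ≈⟨ +-cong (Σp*e≈Σê*V a m)
                (*-congˡ (+-cong (*-congˡ (elementary-symmetric (m ℕ.+ suc a))) (-‿cong (*-cong p₁≈ê₁ (elementary-symmetric (m ℕ.+ a)))))) ⟩
    Σ a (λ k → sgn (suc k) * ê (m ℕ.+ k) * V (suc (a ∸ k))) + sgn (suc a) * (natR (m ℕ.+ suc a) * ê (m ℕ.+ suc a) - ê 1 * ê (m ℕ.+ a))
      ≈⟨ +-congˡ (boundary-closed-form a m) ⟩
    Σ a (λ k → sgn (suc k) * ê (m ℕ.+ k) * V (suc (a ∸ k))) + boundary a m
      ≈⟨ ι-rhs a m ⟨
    ι (rhs (suc N) m (suc (suc a))) ∎

theorem2 : ∀ {c ℓ} (K : Char0Field c ℓ) (n m A : ℕ) → .{{_ : NonZero n}} → 1 ≤ m → 2 ≤ A →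
           (ζ : Char0Field.Carrier K) → Char0Field.IsPrimitiveRoot K n ζ →
           Char0Field._≈_ K
             (Char0Field.sumR K (map (λ jj → Char0Field.ℨ K n ζ (expo m A jj)) (upTo m)))
             (Char0Field.ι K (rhs n m A))
theorem2 K zero    m A {{n≢0}} _ _ ζ _ = Irrelevant.⊥-elim (NonZero.nonZero n≢0)
theorem2 K (suc N) m (suc (suc a)) _ (s≤s (s≤s z≤n)) ζ ζ-primitive = ExplicitFormula.lhs≈ι-rhs K N ζ ζ-primitive a m
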